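{- Let $p$ be a prime, let $n,m$ be positive integers and let $\alpha$ be a positive integer. Then for any integers $a$ and $r$, $$ {\rm ord}_p\bigg(\sum_{k\equiv r\pmod{p^\alpha(p-1)}}s(n,k)S(k,m)a^k\bigg)\geq \bigg\lfloor\frac{n-p^\alpha}{p^\alpha(p-1)}\bigg\rfloor-{\rm ord}_p(m!). $$
   Context: The (unsigned) Stirling numbers of the first kind $s(n,k)$ are defined by $x(x+1)\cdots(x+n-1)=\sum_{k=0}^n s(n,k)x^k$, and the Stirling numbers of the second kind $S(n,k)$ by $x^n=\sum_{k=0}^n S(n,k)k!\binom{x}{k}$; $s(0,0)=S(0,0)=1$ and $s(n,k)=S(n,k)=0$ for $k>n$ or $k<0$. The sum is over all integers $k$ in the given residue class. For a prime $p$ and nonzero integer $a$, ${\rm ord}_p(a)=\sup\{i\in\mathbb{N}: p^i\mid a\}$, with ${\rm ord}_p(0)=\infty$; $\lfloor\cdot\rfloor$ is the floor function. -}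

module Defs where

open import Data.Nat as ℕ using (ℕ; zero; suc)
import Data.Nat.Divisibility as ℕD
open import Data.Integer as ℤ using (ℤ; +_; _/ℕ_)
open import Relation.Nullary using (¬_; yes; no)

-- Unsigned Stirling numbers of the first kind s(n,k): coefficients of the
-- rising factorial x(x+1)...(x+n-1) = Σ_k s(n,k) x^k.  Multiplying by (x+n)
-- gives s(n+1,k) = s(n,k-1) + n s(n,k), with s(0,0)=1, s(0,k+1)=0.
stirling1 : ℕ → ℕ → ℕ
stirling1 zero    zero    = 1
stirling1 zero    (suc k) = 0
stirling1 (suc n) zero    = n ℕ.* stirling1 n zero
stirling1 (suc n) (suc k) = stirling1 n k ℕ.+ n ℕ.* stirling1 n (suc k)

stirling2 : ℕ → ℕ → ℕ
stirling2 zero    zero    = 1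
stirling2 zero    (suc k) = 0
stirling2 (suc n) zero    = 0
stirling2 (suc n) (suc k) = stirling2 n k ℕ.+ suc k ℕ.* stirling2 n (suc k)

sumTo : ℕ → (ℕ → ℤ) → ℤ
sumTo zero    f = f 0
sumTo (suc n) f = sumTo n f ℤ.+ f (suc n)

-- Σ_{k ≡ r (mod M)} s(n,k) S(k,m) a^k  over all integers k.
-- Terms with k < 0 or k > n vanish (s(n,k) = 0), so k ranges over 0..n.
-- k ≡ r (mod M) means M ∣ (k - r) in ℤ, i.e. M ∣ |k - r| in ℕ.
stirSum : (n m M : ℕ) (a r : ℤ) → ℤ
stirSum n m M a r = sumTo n term
  where
  term : ℕ → ℤ
  term k with M ℕD.∣? ℤ.∣ + k ℤ.- r ∣
  ... | yes _ = + (stirling1 n k ℕ.* stirling2 k m) ℤ.* (a ℤ.^ k)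
  ... | no  _ = + 0

-- ⌊ x / d ⌋ for d ≥ 1 (floor division; the d = 0 case is never used).
floorDiv : ℤ → ℕ → ℤ
floorDiv x zero    = + 0
floorDiv x (suc d) = x /ℕ suc d

-- ord_p(x) ≥ t  (t an integer, ord_p(0) = ∞):  p^i ∣ x for every i ∈ ℕ with i ≤ t.
OrdGe : ℕ → ℤ → ℤ → Set
OrdGe p x t = ∀ (i : ℕ) → + i ℤ.≤ t → (+ (p ℕ.^ i)) ℤ∣ x
  where open import Data.Integer.Divisibility renaming (_∣_ to _ℤ∣_)

IsOrd : ℕ → ℕ → ℕ → Set
IsOrd p x e = (p ℕ.^ e) ℕD.∣ x × ¬ ((p ℕ.^ suc e) ℕD.∣ x)
  where open import Data.Product using (_×_)

module Submission where

-- Let S be the shift (S u)(x) = u(x - 1) on functions ℤ → ℤ. For y ∈ ℤ the sum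
-- ∑ₖ s(n,k) yᵏ u(r - k) is the value at r of (yS)(yS + 1)⋯(yS + n - 1) u, and taking
-- for u the indicator function of Mℤ, M = pᵅ(p - 1), restricts it to k ≡ r (mod M).
-- Modulo p, any p consecutive factors yS + pJ + i (i < p) multiply to yᵖ S (S^(p-1) - 1).
-- Fleck's congruence (S - 1)^(p-1) ≡ 1 + S + ⋯ + S^(p-1) and (S - 1)ᵖ ≡ Sᵖ - 1 show, by
-- induction on α, that (S^(p-1) - 1)ʲ maps M-periodic functions into p^T ℤ once
-- j ≥ T p^(α-1) (p - 1) + p^(α-1); expanding the product block by block then gives
-- p^T ∣ ∑_{k ≡ r} s(n,k) yᵏ whenever T M + pᵅ ≤ n. Finally m! S(k,m) = ∑ⱼ (-1)^(m-j) C(m,j) jᵏ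
-- writes m! times the sum of the theorem as a combination of such sums with y = j a,
-- and dividing by m! costs ord_p(m!).

module Lemmas where

  open import Function.Base using (_∘_)
  open import Data.Nat.Base as ℕ using (ℕ; zero; suc; 2+; _!)
  import Data.Nat.Properties as ℕP
  import Data.Nat.Divisibility as ℕD
  open import Data.Nat.DivMod using (_/_; _%_; m≡m%n+[m/n]*n; /-monoˡ-≤; m*n/n≡m)
  open import Data.Nat.Combinatorics
    using (_C_; nC1≡n; nCn≡1; nCk≡nC[n∸k]; k>n⇒nCk≡0; nCk+nC[k+1]≡[n+1]C[k+1])
  open import Data.Nat.Primality using (Prime; euclidsLemma; prime⇒nonZero)
  open import Data.Nat.Tactic.RingSolver using () renaming (solve-∀ to ℕ-solve-∀)
  open import Data.Integer.Base using (ℤ; +_; _+_; _*_; _-_; -_; _^_; -1ℤ; ∣_∣; _≤_)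
  open import Data.Integer.Properties
  open import Data.Integer.DivMod using (_%ℕ_; _/ℕ_; n%ℕd<d; a≡a%ℕn+[a/ℕn]*n; [n/ℕd]*d≤n)
  open import Data.Integer.Divisibility.Signed
    using (_∣_; divides; ∣-refl; ∣ᵤ⇒∣; ∣⇒∣ᵤ; ∣m∣n⇒∣m+n; ∣m∣n⇒∣m-n; ∣m+n∣n⇒∣m; ∣m⇒∣-m; ∣m⇒∣m*n; ∣n⇒∣m*n;
           *-monoʳ-∣)
  open import Data.Integer.Tactic.RingSolver using (solve-∀)
  import Algebra.Properties.CommutativeSemigroup as CommSemigroupProperties
  open CommSemigroupProperties +-commutativeSemigroup using () renaming (interchange to +-interchange)
  open CommSemigroupProperties *-commutativeSemigroup using () renaming (x∙yz≈y∙xz to *-left-commute)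
  open import Data.Product using (_,_)
  open import Data.Sum using (inj₁; inj₂)
  open import Relation.Binary.Definitions using (tri<; tri≈; tri>)
  open import Relation.Binary.PropositionalEquality hiding (J)
  open import Relation.Nullary using (¬_; contradiction; Dec; yes; no)
  open import Defs using (sumTo; stirling1; stirling2; stirSum; IsOrd; floorDiv)

  ∑ : ℕ → (ℕ → ℤ) → ℤ
  ∑ zero    f = f 0
  ∑ (suc n) f = f 0 + ∑ n (f ∘ suc)

  ∑-cong : ∀ n {f g : ℕ → ℤ} → f ≗ g → ∑ n f ≡ ∑ n g
  ∑-cong zero    f≗g = f≗g 0
  ∑-cong (suc n) f≗g = cong₂ _+_ (f≗g 0) (∑-cong n (f≗g ∘ suc))

  ∑-+ : ∀ n (f g : ℕ → ℤ) → ∑ n (λ k → f k + g k) ≡ ∑ n f + ∑ n g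
  ∑-+ zero    f g = refl
  ∑-+ (suc n) f g = trans (cong (_+_ (f 0 + g 0)) (∑-+ n (f ∘ suc) (g ∘ suc)))
                          (+-interchange (f 0) (g 0) (∑ n (f ∘ suc)) (∑ n (g ∘ suc)))

  ∑-*ˡ : ∀ n c (f : ℕ → ℤ) → ∑ n (λ k → c * f k) ≡ c * ∑ n f
  ∑-*ˡ zero    c f = refl
  ∑-*ˡ (suc n) c f = trans (cong (_+_ (c * f 0)) (∑-*ˡ n c (f ∘ suc))) (sym (*-distribˡ-+ c (f 0) _))

  ∑-- : ∀ n (f g : ℕ → ℤ) → ∑ n (λ k → f k - g k) ≡ ∑ n f - ∑ n g
  ∑-- n f g = begin
    ∑ n (λ k → f k - g k)          ≡⟨ ∑-+ n f (λ k → - g k) ⟩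
    ∑ n f + ∑ n (λ k → - g k)      ≡⟨ cong (_+_ (∑ n f)) (∑-cong n (λ k → -‿as-* (g k))) ⟩
    ∑ n f + ∑ n (λ k → -1ℤ * g k)  ≡⟨ cong (_+_ (∑ n f)) (∑-*ˡ n -1ℤ g) ⟩
    ∑ n f + -1ℤ * ∑ n g            ≡⟨ cong (_+_ (∑ n f)) (sym (-‿as-* (∑ n g))) ⟩
    ∑ n f - ∑ n g                  ∎
    where
    open ≡-Reasoning
    -‿as-* : ∀ x → - x ≡ -1ℤ * x
    -‿as-* = solve-∀

  ∑-last : ∀ n (f : ℕ → ℤ) → ∑ (suc n) f ≡ ∑ n f + f (suc n)
  ∑-last zero    f = refl
  ∑-last (suc n) f = trans (cong (_+_ (f 0)) (∑-last n (f ∘ suc))) (sym (+-assoc (f 0) _ _))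

  ∑-comm : ∀ n m (f : ℕ → ℕ → ℤ) → ∑ n (λ k → ∑ m (f k)) ≡ ∑ m (λ j → ∑ n (λ k → f k j))
  ∑-comm zero    m f = refl
  ∑-comm (suc n) m f = trans (cong (_+_ (∑ m (f 0))) (∑-comm n m (f ∘ suc)))
                             (sym (∑-+ m (f 0) (λ j → ∑ n (λ k → f (suc k) j))))

  ∑-telescope : ∀ n (g : ℕ → ℤ) → ∑ n (λ k → g (suc k) - g k) ≡ g (suc n) - g 0
  ∑-telescope zero    g = refl
  ∑-telescope (suc n) g = trans (cong (_+_ (g 1 - g 0)) (∑-telescope n (g ∘ suc)))
                                (collapse (g 0) (g 1) (g (2+ n)))
    where
    collapse : ∀ a b c → (b - a) + (c - b) ≡ c - a
    collapse = solve-∀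

  ∑-peel : ∀ n (f : ℕ → ℤ) → f (suc n) ≡ + 0 → ∑ n f ≡ f 0 + ∑ n (f ∘ suc)
  ∑-peel n f f[1+n]≡0 = begin
    ∑ n f                  ≡⟨ sym (+-identityʳ (∑ n f)) ⟩
    ∑ n f + + 0            ≡⟨ cong (_+_ (∑ n f)) (sym f[1+n]≡0) ⟩
    ∑ n f + f (suc n)      ≡⟨ sym (∑-last n f) ⟩
    f 0 + ∑ n (f ∘ suc)    ∎
    where open ≡-Reasoning

  ∑-∣ : ∀ n {d} {f : ℕ → ℤ} → (∀ k → k ℕ.≤ n → d ∣ f k) → d ∣ ∑ n f
  ∑-∣ zero    d∣f = d∣f 0 ℕ.z≤n
  ∑-∣ (suc n) d∣f = ∣m∣n⇒∣m+n (d∣f 0 ℕ.z≤n) (∑-∣ n (λ k k≤n → d∣f (suc k) (ℕ.s≤s k≤n)))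

  ∑-cong-mod : ∀ n {d} (f g : ℕ → ℤ) → (∀ k → k ℕ.≤ n → d ∣ f k - g k) → d ∣ ∑ n f - ∑ n g
  ∑-cong-mod n {d} f g d∣f-g = subst (d ∣_) (∑-- n f g) (∑-∣ n d∣f-g)

  sumTo≡∑ : ∀ n f → sumTo n f ≡ ∑ n f
  sumTo≡∑ zero    f = refl
  sumTo≡∑ (suc n) f = trans (cong (_+ f (suc n)) (sumTo≡∑ n f)) (sym (∑-last n f))

  δ : ℕ → ℕ → ℤ
  δ zero    zero    = + 1
  δ zero    (suc k) = + 0
  δ (suc m) zero    = + 0
  δ (suc m) (suc k) = δ m k

  δ-refl : ∀ m → δ m m ≡ + 1
  δ-refl zero    = refl
  δ-refl (suc m) = δ-refl m

  δ-≢ : ∀ {m k} → m ≢ k → δ m k ≡ + 0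
  δ-≢ {zero}  {zero}  m≢k = contradiction refl m≢k
  δ-≢ {zero}  {suc k} m≢k = refl
  δ-≢ {suc m} {zero}  m≢k = refl
  δ-≢ {suc m} {suc k} m≢k = δ-≢ (m≢k ∘ cong suc)

  δ-* : ∀ a k (f : ℕ → ℤ) → δ a k * f k ≡ δ a k * f a
  δ-* zero    zero    f = refl
  δ-* zero    (suc k) f = refl
  δ-* (suc a) zero    f = refl
  δ-* (suc a) (suc k) f = δ-* a k (f ∘ suc)

  ∑-δ : ∀ n m (g : ℕ → ℤ) → m ℕ.≤ n → ∑ n (λ k → δ m k * g k) ≡ g m
  ∑-δ zero    zero    g _ = *-identityˡ (g 0)
  ∑-δ (suc n) zero    g _ = begin
    + 1 * g 0 + ∑ n (λ k → + 0 * g (suc k))  ≡⟨ cong₂ _+_ (*-identityˡ (g 0)) (∑-*ˡ n (+ 0) (g ∘ suc)) ⟩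
    g 0 + + 0 * ∑ n (g ∘ suc)                ≡⟨ +-identityʳ (g 0) ⟩
    g 0                                      ∎
    where open ≡-Reasoning
  ∑-δ (suc n) (suc m) g (ℕ.s≤s m≤n) = trans (cong (_+_ (+ 0 * g 0)) (∑-δ n m (g ∘ suc) m≤n)) (+-identityˡ _)

  ∑-δ-δ : ∀ n a b (g : ℕ → ℤ) → a ℕ.≤ n → b ℕ.≤ n → ∑ n (λ k → (δ a k - δ b k) * g k) ≡ g a - g b
  ∑-δ-δ n a b g a≤n b≤n = begin
    ∑ n (λ k → (δ a k - δ b k) * g k)          ≡⟨ ∑-cong n (λ k → *-distribʳ-- (δ a k) (δ b k) (g k)) ⟩
    ∑ n (λ k → δ a k * g k - δ b k * g k)      ≡⟨ ∑-- n (λ k → δ a k * g k) (λ k → δ b k * g k) ⟩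
    ∑ n (λ k → δ a k * g k) - ∑ n (λ k → δ b k * g k) ≡⟨ cong₂ _-_ (∑-δ n a g a≤n) (∑-δ n b g b≤n) ⟩
    g a - g b                                  ∎
    where
    open ≡-Reasoning
    *-distribʳ-- : ∀ a b c → (a - b) * c ≡ a * c - b * c
    *-distribʳ-- = solve-∀

  -- Polynomials in the shift operator

  -- Integer polynomials in the shift (S u)(x) = u(x - 1), kept as syntax so that
  -- linearity, translation invariance and commutativity hold by induction.

  Fun : Set
  Fun = ℤ → ℤ

  infixl 6 _⊕_
  infixl 7 _⊗_

  data Op : Set where
    I S     : Op
    scalar  : ℤ → Op
    _⊕_ _⊗_ : Op → Op → Op

  ⟦_⟧ : Op → Fun → Fun
  ⟦ I ⟧        u   = u
  ⟦ S ⟧        u x = u (x - + 1)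
  ⟦ scalar c ⟧ u x = c * u x
  ⟦ A ⊕ B ⟧    u x = ⟦ A ⟧ u x + ⟦ B ⟧ u x
  ⟦ A ⊗ B ⟧    u   = ⟦ A ⟧ (⟦ B ⟧ u)

  ⟦⟧-cong : ∀ A {u v} → u ≗ v → ⟦ A ⟧ u ≗ ⟦ A ⟧ v
  ⟦⟧-cong I          u≗v x = u≗v x
  ⟦⟧-cong S          u≗v x = u≗v (x - + 1)
  ⟦⟧-cong (scalar c) u≗v x = cong (c *_) (u≗v x)
  ⟦⟧-cong (A ⊕ B)    u≗v x = cong₂ _+_ (⟦⟧-cong A u≗v x) (⟦⟧-cong B u≗v x)
  ⟦⟧-cong (A ⊗ B)    u≗v x = ⟦⟧-cong A (⟦⟧-cong B u≗v) x

  ⟦⟧-+ : ∀ A u v x → ⟦ A ⟧ (λ z → u z + v z) x ≡ ⟦ A ⟧ u x + ⟦ A ⟧ v x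
  ⟦⟧-+ I          u v x = refl
  ⟦⟧-+ S          u v x = refl
  ⟦⟧-+ (scalar c) u v x = *-distribˡ-+ c (u x) (v x)
  ⟦⟧-+ (A ⊕ B)    u v x = trans (cong₂ _+_ (⟦⟧-+ A u v x) (⟦⟧-+ B u v x))
                                (+-interchange (⟦ A ⟧ u x) (⟦ A ⟧ v x) (⟦ B ⟧ u x) (⟦ B ⟧ v x))
  ⟦⟧-+ (A ⊗ B)    u v x = trans (⟦⟧-cong A (⟦⟧-+ B u v) x) (⟦⟧-+ A _ _ x)

  ⟦⟧-* : ∀ A c u x → ⟦ A ⟧ (λ z → c * u z) x ≡ c * ⟦ A ⟧ u x
  ⟦⟧-* I          c u x = refl
  ⟦⟧-* S          c u x = refl
  ⟦⟧-* (scalar d) c u x = *-left-commute d c (u x)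
  ⟦⟧-* (A ⊕ B)    c u x = trans (cong₂ _+_ (⟦⟧-* A c u x) (⟦⟧-* B c u x)) (sym (*-distribˡ-+ c _ _))
  ⟦⟧-* (A ⊗ B)    c u x = trans (⟦⟧-cong A (⟦⟧-* B c u) x) (⟦⟧-* A c _ x)

  ⟦⟧-translate : ∀ A u c x → ⟦ A ⟧ (λ z → u (z + c)) x ≡ ⟦ A ⟧ u (x + c)
  ⟦⟧-translate I          u c x = refl
  ⟦⟧-translate S          u c x = cong u (shift x c)
    where
    shift : ∀ x c → (x - + 1) + c ≡ (x + c) - + 1
    shift = solve-∀
  ⟦⟧-translate (scalar d) u c x = refl
  ⟦⟧-translate (A ⊕ B)    u c x = cong₂ _+_ (⟦⟧-translate A u c x) (⟦⟧-translate B u c x)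
  ⟦⟧-translate (A ⊗ B)    u c x = trans (⟦⟧-cong A (⟦⟧-translate B u c) x) (⟦⟧-translate A (⟦ B ⟧ u) c x)

  ⟦⟧-comm : ∀ A B u x → ⟦ A ⟧ (⟦ B ⟧ u) x ≡ ⟦ B ⟧ (⟦ A ⟧ u) x
  ⟦⟧-comm A I          u x = refl
  ⟦⟧-comm A S          u x = ⟦⟧-translate A u (- + 1) x
  ⟦⟧-comm A (scalar c) u x = ⟦⟧-* A c u x
  ⟦⟧-comm A (B ⊕ D)    u x = trans (⟦⟧-+ A _ _ x) (cong₂ _+_ (⟦⟧-comm A B u x) (⟦⟧-comm A D u x))
  ⟦⟧-comm A (B ⊗ D)    u x = trans (⟦⟧-comm A B (⟦ D ⟧ u) x) (⟦⟧-cong B (⟦⟧-comm A D u) x)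

  Periodic : ℕ → Fun → Set
  Periodic L u = ∀ x → u (x + + L) ≡ u x

  ⟦⟧-periodic : ∀ A {L u} → Periodic L u → Periodic L (⟦ A ⟧ u)
  ⟦⟧-periodic A {L} {u} u-per x = trans (sym (⟦⟧-translate A u (+ L) x)) (⟦⟧-cong A u-per x)

  infix 4 _∣ᶠ_

  _∣ᶠ_ : ℤ → Fun → Set
  d ∣ᶠ u = ∀ x → d ∣ u x

  ⟦⟧-∣ : ∀ A {d u} → d ∣ᶠ u → d ∣ᶠ ⟦ A ⟧ u
  ⟦⟧-∣ I          d∣u x = d∣u x
  ⟦⟧-∣ S          d∣u x = d∣u (x - + 1)
  ⟦⟧-∣ (scalar c) d∣u x = ∣n⇒∣m*n c (d∣u x)
  ⟦⟧-∣ (A ⊕ B)    d∣u x = ∣m∣n⇒∣m+n (⟦⟧-∣ A d∣u x) (⟦⟧-∣ B d∣u x)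
  ⟦⟧-∣ (A ⊗ B)    d∣u x = ⟦⟧-∣ A (⟦⟧-∣ B d∣u) x

  infix 4 _≈_mod_

  record _≈_mod_ (A B : Op) (π : ℤ) : Set where
    constructor congruent
    field
      quotient : Op
      equality : ∀ u x → ⟦ A ⟧ u x ≡ ⟦ B ⟧ u x + π * ⟦ quotient ⟧ u x

  open _≈_mod_

  ≈-reflexive : ∀ {π} A B → (∀ u x → ⟦ A ⟧ u x ≡ ⟦ B ⟧ u x) → A ≈ B mod π
  ≈-reflexive {π} A B A≗B = congruent (scalar (+ 0)) λ u x →
    trans (A≗B u x) (sym (trans (cong (_+_ (⟦ B ⟧ u x)) (*-zeroʳ π)) (+-identityʳ _)))

  ≈-refl : ∀ {π} A → A ≈ A mod π
  ≈-refl A = ≈-reflexive A A (λ u x → refl)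

  ≈-trans : ∀ {π A B D} → A ≈ B mod π → B ≈ D mod π → A ≈ D mod π
  ≈-trans {π} {A} {B} {D} (congruent H A≈B) (congruent K B≈D) = congruent (K ⊕ H) λ u x →
    trans (A≈B u x) (trans (cong (_+ π * ⟦ H ⟧ u x) (B≈D u x)) (regroup (⟦ D ⟧ u x) π _ _))
    where
    regroup : ∀ c π k h → (c + π * k) + π * h ≡ c + π * (k + h)
    regroup = solve-∀

  ⊕-cong : ∀ {π A A′ B B′} → A ≈ A′ mod π → B ≈ B′ mod π → A ⊕ B ≈ A′ ⊕ B′ mod π
  ⊕-cong {π} {A′ = A′} {B′ = B′} (congruent H A≈A′) (congruent K B≈B′) = congruent (H ⊕ K) λ u x →
    trans (cong₂ _+_ (A≈A′ u x) (B≈B′ u x)) (regroup (⟦ A′ ⟧ u x) (⟦ B′ ⟧ u x) π _ _)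
    where
    regroup : ∀ a b π h k → (a + π * h) + (b + π * k) ≡ (a + b) + π * (h + k)
    regroup = solve-∀

  ⊗-cong : ∀ {π A A′ B B′} → A ≈ A′ mod π → B ≈ B′ mod π → A ⊗ B ≈ A′ ⊗ B′ mod π
  ⊗-cong {π} {A} {A′} {B} {B′} (congruent H A≈A′) (congruent K B≈B′) =
    congruent (A′ ⊗ K ⊕ H ⊗ B) λ u x → begin
      ⟦ A ⟧ (⟦ B ⟧ u) x
        ≡⟨ A≈A′ (⟦ B ⟧ u) x ⟩
      ⟦ A′ ⟧ (⟦ B ⟧ u) x + π * ⟦ H ⟧ (⟦ B ⟧ u) x
        ≡⟨ cong (_+ π * ⟦ H ⟧ (⟦ B ⟧ u) x) (⟦⟧-cong A′ (B≈B′ u) x) ⟩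
      ⟦ A′ ⟧ (λ z → ⟦ B′ ⟧ u z + π * ⟦ K ⟧ u z) x + π * ⟦ H ⟧ (⟦ B ⟧ u) x
        ≡⟨ cong (_+ π * ⟦ H ⟧ (⟦ B ⟧ u) x) (trans (⟦⟧-+ A′ (⟦ B′ ⟧ u) (λ z → π * ⟦ K ⟧ u z) x)
                                                (cong (_+_ (⟦ A′ ⟧ (⟦ B′ ⟧ u) x)) (⟦⟧-* A′ π (⟦ K ⟧ u) x))) ⟩
      (⟦ A′ ⟧ (⟦ B′ ⟧ u) x + π * ⟦ A′ ⟧ (⟦ K ⟧ u) x) + π * ⟦ H ⟧ (⟦ B ⟧ u) x
        ≡⟨ regroup (⟦ A′ ⟧ (⟦ B′ ⟧ u) x) π _ _ ⟩
      ⟦ A′ ⟧ (⟦ B′ ⟧ u) x + π * (⟦ A′ ⟧ (⟦ K ⟧ u) x + ⟦ H ⟧ (⟦ B ⟧ u) x) ∎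
    where
    open ≡-Reasoning
    regroup : ∀ a π k h → (a + π * k) + π * h ≡ a + π * (k + h)
    regroup = solve-∀

  scalar-cong : ∀ {π} c c′ → π ∣ c - c′ → scalar c ≈ scalar c′ mod π
  scalar-cong {π} c c′ (divides k c-c′≡kπ) = congruent (scalar k) λ u x → begin
    c * u x                     ≡⟨ cong (_* u x) (split c c′) ⟩
    (c′ + (c - c′)) * u x       ≡⟨ cong (λ d → (c′ + d) * u x) c-c′≡kπ ⟩
    (c′ + k * π) * u x          ≡⟨ expand c′ k π (u x) ⟩
    c′ * u x + π * (k * u x)    ∎
    where
    open ≡-Reasoning
    split : ∀ c c′ → c ≡ c′ + (c - c′)
    split = solve-∀
    expand : ∀ c′ k π y → (c′ + k * π) * y ≡ c′ * y + π * (k * y)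
    expand = solve-∀

  Prod : (ℕ → Op) → ℕ → Op
  Prod f zero    = I
  Prod f (suc n) = f n ⊗ Prod f n

  pow : Op → ℕ → Op
  pow A = Prod (λ _ → A)

  Prod-+ : ∀ f a b u x → ⟦ Prod f (a ℕ.+ b) ⟧ u x ≡ ⟦ Prod (λ i → f (a ℕ.+ i)) b ⟧ (⟦ Prod f a ⟧ u) x
  Prod-+ f a zero    u x rewrite ℕP.+-identityʳ a = refl
  Prod-+ f a (suc b) u x rewrite ℕP.+-suc a b     = ⟦⟧-cong (f (a ℕ.+ b)) (Prod-+ f a b u) x

  Prod-cong : ∀ {π} f g n → (∀ i → f i ≈ g i mod π) → Prod f n ≈ Prod g n mod π
  Prod-cong f g zero    f≈g = ≈-refl I
  Prod-cong f g (suc n) f≈g = ⊗-cong (f≈g n) (Prod-cong f g n f≈g)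

  Prod-blocks : ∀ d f K u x →
    ⟦ Prod f (d ℕ.* K) ⟧ u x ≡ ⟦ Prod (λ J → Prod (λ i → f (d ℕ.* J ℕ.+ i)) d) K ⟧ u x
  Prod-blocks d f zero    u x rewrite ℕP.*-zeroʳ d = refl
  Prod-blocks d f (suc K) u x = begin
    ⟦ Prod f (d ℕ.* suc K) ⟧ u x
      ≡⟨ cong (λ n → ⟦ Prod f n ⟧ u x) (trans (ℕP.*-suc d K) (ℕP.+-comm d (d ℕ.* K))) ⟩
    ⟦ Prod f (d ℕ.* K ℕ.+ d) ⟧ u x
      ≡⟨ Prod-+ f (d ℕ.* K) d u x ⟩
    ⟦ Prod (λ i → f (d ℕ.* K ℕ.+ i)) d ⟧ (⟦ Prod f (d ℕ.* K) ⟧ u) x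
      ≡⟨ ⟦⟧-cong (Prod (λ i → f (d ℕ.* K ℕ.+ i)) d) (Prod-blocks d f K u) x ⟩
    ⟦ Prod (λ J → Prod (λ i → f (d ℕ.* J ℕ.+ i)) d) (suc K) ⟧ u x ∎
    where open ≡-Reasoning

  pow-S : ∀ k u x → ⟦ pow S k ⟧ u x ≡ u (x - + k)
  pow-S zero    u x = cong u (sym (+-identityʳ x))
  pow-S (suc k) u x = trans (pow-S k u (x - + 1)) (cong u (shift x (+ k)))
    where
    shift : ∀ x k → (x - + 1) - k ≡ x - (+ 1 + k)
    shift = solve-∀

  poly : (ℕ → ℤ) → ℕ → Op
  poly c zero    = scalar (c 0)
  poly c (suc n) = scalar (c 0) ⊕ S ⊗ poly (c ∘ suc) n

  ⟦poly⟧ : ∀ c n u x → ⟦ poly c n ⟧ u x ≡ ∑ n (λ k → c k * u (x - + k))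
  ⟦poly⟧ c zero    u x = cong (λ y → c 0 * u y) (sym (+-identityʳ x))
  ⟦poly⟧ c (suc n) u x = cong₂ _+_ (cong (λ y → c 0 * u y) (sym (+-identityʳ x))) (begin
    ⟦ poly (c ∘ suc) n ⟧ u (x - + 1)
      ≡⟨ ⟦poly⟧ (c ∘ suc) n u (x - + 1) ⟩
    ∑ n (λ k → c (suc k) * u ((x - + 1) - + k))
      ≡⟨ ∑-cong n (λ k → cong (λ y → c (suc k) * u y) (shift x (+ k))) ⟩
    ∑ n (λ k → c (suc k) * u (x - + suc k)) ∎)
    where
    open ≡-Reasoning
    shift : ∀ x k → (x - + 1) - k ≡ x - (+ 1 + k)
    shift = solve-∀

  poly-cong : ∀ {π} n c c′ → (∀ k → k ℕ.≤ n → π ∣ c k - c′ k) → poly c n ≈ poly c′ n mod π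
  poly-cong zero    c c′ c≡c′ = scalar-cong (c 0) (c′ 0) (c≡c′ 0 ℕ.z≤n)
  poly-cong (suc n) c c′ c≡c′ = ⊕-cong (scalar-cong (c 0) (c′ 0) (c≡c′ 0 ℕ.z≤n))
    (⊗-cong (≈-refl S) (poly-cong n (c ∘ suc) (c′ ∘ suc) (λ k k≤n → c≡c′ (suc k) (ℕ.s≤s k≤n))))

  module LinearFactors (a : ℤ) (b : ℕ → ℤ) (c : ℕ → ℕ → ℤ)
    (c-0-0     : c 0 0 ≡ + 1)
    (c-above   : ∀ n → c n (suc n) ≡ + 0)
    (c-suc-0   : ∀ n → c (suc n) 0 ≡ b n * c n 0)
    (c-suc-suc : ∀ n k → c (suc n) (suc k) ≡ a * c n k + b n * c n (suc k)) where

    factor : ℕ → Op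
    factor i = scalar a ⊗ S ⊕ scalar (b i)

    ⟦Prod-factor⟧ : ∀ n u x → ⟦ Prod factor n ⟧ u x ≡ ∑ n (λ k → c n k * u (x - + k))
    ⟦Prod-factor⟧ zero    u x = begin
      u x                  ≡⟨ cong u (sym (+-identityʳ x)) ⟩
      u (x - + 0)          ≡⟨ sym (*-identityˡ _) ⟩
      + 1 * u (x - + 0)    ≡⟨ cong (_* u (x - + 0)) (sym c-0-0) ⟩
      c 0 0 * u (x - + 0)  ∎
      where open ≡-Reasoning
    ⟦Prod-factor⟧ (suc n) u x = begin
      a * W (x - + 1) + b n * W x
        ≡⟨ cong₂ (λ s t → a * s + b n * t) (⟦Prod-factor⟧ n u (x - + 1)) (⟦Prod-factor⟧ n u x) ⟩
      a * ∑ n (λ k → c n k * u ((x - + 1) - + k)) + b n * ∑ n F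
        ≡⟨ cong₂ (λ s t → a * s + b n * t) (∑-cong n (λ k → cong (λ z → c n k * u z) (shift x (+ k))))
                                           (∑-peel n F (F-above)) ⟩
      a * ∑ n G + b n * (F 0 + ∑ n (F ∘ suc))
        ≡⟨ regroup a (b n) (∑ n G) (c n 0) (u (x - + 0)) (∑ n (F ∘ suc)) ⟩
      b n * c n 0 * u (x - + 0) + (a * ∑ n G + b n * ∑ n (F ∘ suc))
        ≡⟨ cong (_+_ (b n * c n 0 * u (x - + 0)))
                (sym (trans (∑-+ n (λ k → a * G k) (λ k → b n * F (suc k)))
                            (cong₂ _+_ (∑-*ˡ n a G) (∑-*ˡ n (b n) (F ∘ suc))))) ⟩
      b n * c n 0 * u (x - + 0) + ∑ n (λ k → a * G k + b n * F (suc k))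
        ≡⟨ cong₂ _+_ (cong (_* u (x - + 0)) (sym (c-suc-0 n)))
                     (∑-cong n (λ k → trans (collect a (c n k) (b n) (c n (suc k)) (u (x - + suc k)))
                                            (cong (_* u (x - + suc k)) (sym (c-suc-suc n k))))) ⟩
      c (suc n) 0 * u (x - + 0) + ∑ n (λ k → c (suc n) (suc k) * u (x - + suc k)) ∎
      where
      open ≡-Reasoning
      W = ⟦ Prod factor n ⟧ u
      F G : ℕ → ℤ
      F k = c n k * u (x - + k)
      G k = c n k * u (x - + suc k)
      F-above : F (suc n) ≡ + 0
      F-above = trans (cong (_* u (x - + suc n)) (c-above n)) (*-zeroˡ (u (x - + suc n)))
      shift : ∀ x k → (x - + 1) - k ≡ x - (+ 1 + k)
      shift = solve-∀
      regroup : ∀ a b A c₀ u₀ B → a * A + b * (c₀ * u₀ + B) ≡ b * c₀ * u₀ + (a * A + b * B)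
      regroup = solve-∀
      collect : ∀ a c b d y → a * (c * y) + b * (d * y) ≡ (a * c + b * d) * y
      collect = solve-∀

  pascal : ∀ n k → suc n C suc k ≡ n C k ℕ.+ n C suc k
  pascal n k = sym (nCk+nC[k+1]≡[n+1]C[k+1] n k)

  C-absorb : ∀ n k → suc k ℕ.* (suc n C suc k) ≡ suc n ℕ.* (n C k)
  C-absorb zero    zero    = refl
  C-absorb zero    (suc k) = ℕP.*-zeroʳ (2+ k)
  C-absorb (suc n) zero    = trans (ℕP.*-identityˡ _) (trans (nC1≡n (2+ n)) (sym (ℕP.*-identityʳ (2+ n))))
  C-absorb (suc n) (suc k) = begin
    2+ k ℕ.* (2+ n C 2+ k)
      ≡⟨ cong (2+ k ℕ.*_) (pascal (suc n) (suc k)) ⟩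
    2+ k ℕ.* (suc n C suc k ℕ.+ suc n C 2+ k)
      ≡⟨ spread k (suc n C suc k) (suc n C 2+ k) ⟩
    suc k ℕ.* (suc n C suc k) ℕ.+ suc n C suc k ℕ.+ 2+ k ℕ.* (suc n C 2+ k)
      ≡⟨ cong₂ (λ a b → a ℕ.+ suc n C suc k ℕ.+ b) (C-absorb n k) (C-absorb n (suc k)) ⟩
    suc n ℕ.* (n C k) ℕ.+ suc n C suc k ℕ.+ suc n ℕ.* (n C suc k)
      ≡⟨ cong (λ a → suc n ℕ.* (n C k) ℕ.+ a ℕ.+ suc n ℕ.* (n C suc k)) (pascal n k) ⟩
    suc n ℕ.* (n C k) ℕ.+ (n C k ℕ.+ n C suc k) ℕ.+ suc n ℕ.* (n C suc k)
      ≡⟨ gather n (n C k) (n C suc k) ⟩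
    2+ n ℕ.* (n C k ℕ.+ n C suc k)
      ≡⟨ cong (2+ n ℕ.*_) (sym (pascal n k)) ⟩
    2+ n ℕ.* (suc n C suc k) ∎
    where
    open ≡-Reasoning
    spread : ∀ k a b → 2+ k ℕ.* (a ℕ.+ b) ≡ suc k ℕ.* a ℕ.+ a ℕ.+ 2+ k ℕ.* b
    spread = ℕ-solve-∀
    gather : ∀ n a b → suc n ℕ.* a ℕ.+ (a ℕ.+ b) ℕ.+ suc n ℕ.* b ≡ 2+ n ℕ.* (a ℕ.+ b)
    gather = ℕ-solve-∀

  C-complement : ∀ m j → (+ suc m - + j) * + (suc m C j) ≡ + suc m * + (m C j)
  C-complement m zero    = cong (_* + 1) (+-identityʳ (+ suc m))
  C-complement m (suc j) = begin
    (M - J) * + (suc m C suc j)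
      ≡⟨ *-distribʳ-- M J (+ (suc m C suc j)) ⟩
    M * + (suc m C suc j) - J * + (suc m C suc j)
      ≡⟨ cong₂ (λ a b → M * a - b) (trans (cong +_ (pascal m j)) (pos-+ (m C j) _)) absorb ⟩
    M * (+ (m C j) + + (m C suc j)) - M * + (m C j)
      ≡⟨ cancel M (+ (m C j)) (+ (m C suc j)) ⟩
    M * + (m C suc j) ∎
    where
    open ≡-Reasoning
    M = + suc m
    J = + suc j
    absorb : J * + (suc m C suc j) ≡ M * + (m C j)
    absorb = trans (sym (pos-* (suc j) _)) (trans (cong +_ (C-absorb m j)) (pos-* (suc m) _))
    *-distribʳ-- : ∀ a b c → (a - b) * c ≡ a * c - b * c
    *-distribʳ-- = solve-∀
    cancel : ∀ m a b → m * (a + b) - m * a ≡ m * b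
    cancel = solve-∀

  [1+n]Cn≡1+n : ∀ n → suc n C n ≡ suc n
  [1+n]Cn≡1+n n = trans (nCk≡nC[n∸k] (ℕP.n≤1+n n)) (trans (cong (suc n C_) (ℕP.m+n∸n≡m 1 n)) (nC1≡n (suc n)))

  -1^n*-1^n≡1 : ∀ n → -1ℤ ^ n * -1ℤ ^ n ≡ + 1
  -1^n*-1^n≡1 zero    = refl
  -1^n*-1^n≡1 (suc n) = trans (square-neg (-1ℤ ^ n)) (-1^n*-1^n≡1 n)
    where
    square-neg : ∀ s → (-1ℤ * s) * (-1ℤ * s) ≡ s * s
    square-neg = solve-∀

  signedBinom : ℕ → ℕ → ℤ
  signedBinom n k = -1ℤ ^ (n ℕ.+ k) * + (n C k)

  signedBinom-above : ∀ n → signedBinom n (suc n) ≡ + 0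
  signedBinom-above n = trans (cong (λ c → -1ℤ ^ (n ℕ.+ suc n) * + c) (k>n⇒nCk≡0 (ℕP.n<1+n n)))
                              (*-zeroʳ (-1ℤ ^ (n ℕ.+ suc n)))

  signedBinom-suc-suc : ∀ n k → signedBinom (suc n) (suc k) ≡ + 1 * signedBinom n k + -1ℤ * signedBinom n (suc k)
  signedBinom-suc-suc n k rewrite ℕP.+-suc n k | pascal n k | pos-+ (n C k) (n C suc k) =
    pascal-sign (-1ℤ ^ (n ℕ.+ k)) (+ (n C k)) (+ (n C suc k))
    where
    pascal-sign : ∀ s a b → (-1ℤ * (-1ℤ * s)) * (a + b) ≡ + 1 * (s * a) + -1ℤ * ((-1ℤ * s) * b)
    pascal-sign = solve-∀

  signedBinom-shift : ∀ m j → signedBinom (suc m) j * (+ j - + suc m) ≡ + suc m * signedBinom m j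
  signedBinom-shift m j = begin
    (-1ℤ * s * c) * (+ j - + suc m)    ≡⟨ flip s c (+ j) (+ suc m) ⟩
    s * ((+ suc m - + j) * c)          ≡⟨ cong (s *_) (C-complement m j) ⟩
    s * (+ suc m * + (m C j))          ≡⟨ *-left-commute s (+ suc m) (+ (m C j)) ⟩
    + suc m * (s * + (m C j))          ∎
    where
    open ≡-Reasoning
    s = -1ℤ ^ (m ℕ.+ j)
    c = + (suc m C j)
    flip : ∀ s c j m → (-1ℤ * s * c) * (j - m) ≡ s * ((m - j) * c)
    flip = solve-∀

  Δ : Op
  Δ = scalar (+ 1) ⊗ S ⊕ scalar -1ℤ

  module Differences = LinearFactors (+ 1) (λ _ → -1ℤ) signedBinom refl signedBinom-above
    (λ n → *-assoc -1ℤ (-1ℤ ^ (n ℕ.+ 0)) (+ 1)) signedBinom-suc-suc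

  ⟦pow-Δ⟧ : ∀ n u x → ⟦ pow Δ n ⟧ u x ≡ ∑ n (λ k → signedBinom n k * u (x - + k))
  ⟦pow-Δ⟧ = Differences.⟦Prod-factor⟧

  pow-Δ≈poly : ∀ {π} n → pow Δ n ≈ poly (signedBinom n) n mod π
  pow-Δ≈poly n = ≈-reflexive (pow Δ n) (poly (signedBinom n) n)
    (λ u x → trans (⟦pow-Δ⟧ n u x) (sym (⟦poly⟧ (signedBinom n) n u x)))

  ∑-signedBinom : ∀ m → ∑ (suc m) (λ k → signedBinom (suc m) k * + 1) ≡ + 0
  ∑-signedBinom m = begin
    ∑ (suc m) (λ k → signedBinom (suc m) k * + 1)    ≡⟨ sym (⟦pow-Δ⟧ (suc m) (λ _ → + 1) (+ 0)) ⟩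
    + 1 * W -1ℤ + -1ℤ * W (+ 0)                      ≡⟨ cong (λ w → + 1 * w + -1ℤ * W (+ 0)) W-constant ⟩
    + 1 * W (+ 0) + -1ℤ * W (+ 0)                    ≡⟨ cancel (W (+ 0)) ⟩
    + 0                                              ∎
    where
    open ≡-Reasoning
    W = ⟦ pow Δ m ⟧ (λ _ → + 1)
    W-constant : W -1ℤ ≡ W (+ 0)
    W-constant = sym (⟦⟧-periodic (pow Δ m) {L = 1} (λ _ → refl) -1ℤ)
    cancel : ∀ w → + 1 * w + -1ℤ * w ≡ + 0
    cancel = solve-∀

  Δ[_] : ℕ → Op
  Δ[ d ] = pow S d ⊕ scalar -1ℤ

  ⟦Δ[]⟧ : ∀ d u x → ⟦ Δ[ d ] ⟧ u x ≡ u (x - + d) - u x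
  ⟦Δ[]⟧ d u x = cong₂ _+_ (pow-S d u x) (-1*x≡-x (u x))
    where
    -1*x≡-x : ∀ x → -1ℤ * x ≡ - x
    -1*x≡-x = solve-∀

  -- ∑_{k ≤ L} Sᵏ (S - 1) = S^(L+1) - 1 telescopes.
  ∑S^k∘Δ-periodic≡0 : ∀ L u → Periodic (suc L) u → ∀ x → ⟦ poly (λ _ → + 1) L ⟧ (⟦ Δ ⟧ u) x ≡ + 0
  ∑S^k∘Δ-periodic≡0 L u u-per x = begin
    ⟦ poly (λ _ → + 1) L ⟧ (⟦ Δ ⟧ u) x
      ≡⟨ ⟦poly⟧ (λ _ → + 1) L (⟦ Δ ⟧ u) x ⟩
    ∑ L (λ k → + 1 * (+ 1 * u ((x - + k) - + 1) + -1ℤ * u (x - + k)))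
      ≡⟨ ∑-cong L (λ k → trans (difference (u ((x - + k) - + 1)) (u (x - + k)))
                               (cong (λ z → u z - u (x - + k)) (shift x (+ k)))) ⟩
    ∑ L (λ k → g (suc k) - g k)
      ≡⟨ ∑-telescope L g ⟩
    u (x - + suc L) - u (x - + 0)
      ≡⟨ cong₂ _-_ (trans (sym (u-per (x - + suc L))) (cong u (x-L+L≡x x (+ suc L)))) (cong u (+-identityʳ x)) ⟩
    u x - u x
      ≡⟨ +-inverseʳ (u x) ⟩
    + 0 ∎
    where
    open ≡-Reasoning
    g : ℕ → ℤ
    g k = u (x - + k)
    difference : ∀ a b → + 1 * (+ 1 * a + -1ℤ * b) ≡ a - b
    difference = solve-∀
    shift : ∀ x k → (x - k) - + 1 ≡ x - (+ 1 + k)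
    shift = solve-∀
    x-L+L≡x : ∀ x l → (x - l) + l ≡ x
    x-L+L≡x = solve-∀

  -- Stirling numbers

  s₁ : ℕ → ℕ → ℤ
  s₁ n k = + stirling1 n k

  stirling1-above : ∀ {n k} → n ℕ.< k → stirling1 n k ≡ 0
  stirling1-above {zero}  {suc k} _ = refl
  stirling1-above {suc n} {suc k} (ℕ.s≤s n<k)
    rewrite stirling1-above n<k | stirling1-above (ℕP.m<n⇒m<1+n n<k) = ℕP.*-zeroʳ n

  stirling1-suc-0 : ∀ n → stirling1 (suc n) 0 ≡ 0
  stirling1-suc-0 zero    = refl
  stirling1-suc-0 (suc n) rewrite stirling1-suc-0 n = ℕP.*-zeroʳ (suc n)

  stirling1-diag : ∀ n → stirling1 n n ≡ 1
  stirling1-diag zero    = refl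
  stirling1-diag (suc n) rewrite stirling1-diag n | stirling1-above (ℕP.n<1+n n) | ℕP.*-zeroʳ n = refl

  s₁-suc-suc : ∀ n k → s₁ (suc n) (suc k) ≡ s₁ n k + + n * s₁ n (suc k)
  s₁-suc-suc n k = trans (pos-+ (stirling1 n k) _) (cong (_+_ (s₁ n k)) (pos-* n _))

  n*s₁[n,0]≡0 : ∀ n → + n * s₁ n 0 ≡ + 0
  n*s₁[n,0]≡0 zero    = refl
  n*s₁[n,0]≡0 (suc n) = trans (cong (λ s → + suc n * + s) (stirling1-suc-0 n)) (*-zeroʳ (+ suc n))

  s₁-rising-recursion : ∀ y n k →
    s₁ (suc n) (suc k) * y ^ suc k ≡ y * (s₁ n k * y ^ k) + + n * (s₁ n (suc k) * y ^ suc k)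
  s₁-rising-recursion y n k =
    trans (cong (_* (y * y ^ k)) (s₁-suc-suc n k)) (distribute (s₁ n k) (+ n) (s₁ n (suc k)) y (y ^ k))
    where
    distribute : ∀ a n b y w → (a + n * b) * (y * w) ≡ y * (a * w) + n * (b * (y * w))
    distribute = solve-∀

  module Rising (y : ℤ) = LinearFactors y +_ (λ n k → s₁ n k * y ^ k) refl
    (λ n → cong (λ s → + s * y ^ suc n) (stirling1-above (ℕP.n<1+n n)))
    (λ n → trans (cong (_* + 1) (pos-* n (stirling1 n 0))) (*-assoc (+ n) (s₁ n 0) (+ 1)))
    (s₁-rising-recursion y)

  rising : ℤ → ℕ → ℤ
  rising y zero    = + 1
  rising y (suc n) = (y + + n) * rising y n

  rising-expansion : ∀ y n → rising y n ≡ ∑ n (λ k → s₁ n k * y ^ k)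
  rising-expansion y n = begin
    rising y n                                ≡⟨ sym (⟦Prod⟧-constant n (+ 0)) ⟩
    ⟦ Prod factor n ⟧ (λ _ → + 1) (+ 0)       ≡⟨ ⟦Prod-factor⟧ n (λ _ → + 1) (+ 0) ⟩
    ∑ n (λ k → s₁ n k * y ^ k * + 1)          ≡⟨ ∑-cong n (λ k → *-identityʳ (s₁ n k * y ^ k)) ⟩
    ∑ n (λ k → s₁ n k * y ^ k)                ∎
    where
    open ≡-Reasoning
    open Rising y
    ⟦Prod⟧-constant : ∀ n x → ⟦ Prod factor n ⟧ (λ _ → + 1) x ≡ rising y n
    ⟦Prod⟧-constant zero    x = refl
    ⟦Prod⟧-constant (suc n) x =
      trans (cong₂ (λ a b → y * a + + n * b) (⟦Prod⟧-constant n (x - + 1)) (⟦Prod⟧-constant n x))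
            (sym (*-distribʳ-+ (rising y n) y (+ n)))

  private
    R : ℕ → ℕ → ℤ
    R n k = ∑ n (λ j → s₁ n j * + (j C k))

    R-suc : ∀ n k → R (suc n) k ≡ ∑ n (λ j → s₁ n j * + (suc j C k)) + + n * R n k
    R-suc n k = begin
      s₁ (suc n) 0 * + (0 C k) + ∑ n (λ j → s₁ (suc n) (suc j) * + (suc j C k))
        ≡⟨ cong₂ (λ a b → + a * + (0 C k) + b) (stirling1-suc-0 n)
                 (∑-cong n (λ j → cong (_* + (suc j C k)) (s₁-suc-suc n j))) ⟩
      + 0 + ∑ n (λ j → (s₁ n j + + n * s₁ n (suc j)) * + (suc j C k))
        ≡⟨ +-identityˡ _ ⟩
      ∑ n (λ j → (s₁ n j + + n * s₁ n (suc j)) * + (suc j C k))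
        ≡⟨ ∑-cong n (λ j → trans (*-distribʳ-+ (+ (suc j C k)) (s₁ n j) (+ n * s₁ n (suc j)))
                                 (cong (_+_ (s₁ n j * + (suc j C k)))
                                       (*-assoc (+ n) (s₁ n (suc j)) (+ (suc j C k))))) ⟩
      ∑ n (λ j → s₁ n j * + (suc j C k) + + n * G (suc j))
        ≡⟨ ∑-+ n (λ j → s₁ n j * + (suc j C k)) (λ j → + n * G (suc j)) ⟩
      ∑ n (λ j → s₁ n j * + (suc j C k)) + ∑ n (λ j → + n * G (suc j))
        ≡⟨ cong (_+_ (∑ n (λ j → s₁ n j * + (suc j C k)))) (trans (∑-*ˡ n (+ n) (G ∘ suc)) n*∑G∘suc) ⟩
      ∑ n (λ j → s₁ n j * + (suc j C k)) + + n * R n k ∎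
      where
      open ≡-Reasoning
      G : ℕ → ℤ
      G j = s₁ n j * + (j C k)
      G-above : G (suc n) ≡ + 0
      G-above = cong (λ s → + s * + (suc n C k)) (stirling1-above (ℕP.n<1+n n))
      n*G0≡0 : + n * G 0 ≡ + 0
      n*G0≡0 = trans (sym (*-assoc (+ n) (s₁ n 0) _)) (cong (_* + (0 C k)) (n*s₁[n,0]≡0 n))
      n*∑G∘suc : + n * ∑ n (G ∘ suc) ≡ + n * R n k
      n*∑G∘suc = begin
        + n * ∑ n (G ∘ suc)                ≡⟨ sym (+-identityˡ _) ⟩
        + 0 + + n * ∑ n (G ∘ suc)          ≡⟨ cong (_+ + n * ∑ n (G ∘ suc)) (sym n*G0≡0) ⟩
        + n * G 0 + + n * ∑ n (G ∘ suc)    ≡⟨ sym (*-distribˡ-+ (+ n) (G 0) _) ⟩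
        + n * (G 0 + ∑ n (G ∘ suc))        ≡⟨ cong (+ n *_) (sym (∑-peel n G G-above)) ⟩
        + n * R n k                        ∎

  -- x (x + 1) ⋯ (x + n) = x ∑ⱼ s(n, j) (x + 1)ʲ, compared coefficientwise.
  s₁-binomial : ∀ n k → s₁ (suc n) (suc k) ≡ ∑ n (λ j → s₁ n j * + (j C k))
  s₁-binomial zero    zero    = refl
  s₁-binomial zero    (suc k) = refl
  s₁-binomial (suc n) zero    = begin
    s₁ (2+ n) 1
      ≡⟨ s₁-suc-suc (suc n) 0 ⟩
    s₁ (suc n) 0 + + suc n * s₁ (suc n) 1
      ≡⟨ cong₂ (λ a b → + a + + suc n * b) (stirling1-suc-0 n) (s₁-binomial n 0) ⟩
    + 0 + + suc n * R n 0
      ≡⟨ +-identityˡ _ ⟩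
    + suc n * R n 0
      ≡⟨ cong (_* R n 0) (pos-+ 1 n) ⟩
    (+ 1 + + n) * R n 0
      ≡⟨ split (+ n) (R n 0) ⟩
    R n 0 + + n * R n 0
      ≡⟨ sym (R-suc n 0) ⟩
    R (suc n) 0 ∎
    where
    open ≡-Reasoning
    split : ∀ n r → (+ 1 + n) * r ≡ r + n * r
    split = solve-∀
  s₁-binomial (suc n) (suc k) = begin
    s₁ (2+ n) (2+ k)
      ≡⟨ s₁-suc-suc (suc n) (suc k) ⟩
    s₁ (suc n) (suc k) + + suc n * s₁ (suc n) (2+ k)
      ≡⟨ cong₂ (λ a b → a + + suc n * b) (s₁-binomial n k) (s₁-binomial n (suc k)) ⟩
    R n k + + suc n * R n (suc k)
      ≡⟨ regroup (R n k) (R n (suc k)) (+ n) ⟩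
    (R n k + R n (suc k)) + + n * R n (suc k)
      ≡⟨ cong (_+ + n * R n (suc k)) (sym (∑-pascal n k)) ⟩
    ∑ n (λ j → s₁ n j * + (suc j C suc k)) + + n * R n (suc k)
      ≡⟨ sym (R-suc n (suc k)) ⟩
    R (suc n) (suc k) ∎
    where
    open ≡-Reasoning
    regroup : ∀ a b n → a + (+ 1 + n) * b ≡ (a + b) + n * b
    regroup = solve-∀
    ∑-pascal : ∀ n k → ∑ n (λ j → s₁ n j * + (suc j C suc k)) ≡ R n k + R n (suc k)
    ∑-pascal n k = trans (∑-cong n (λ j → trans (cong (λ c → s₁ n j * c) (pascal-ℤ j))
                                                (*-distribˡ-+ (s₁ n j) _ _)))
                         (∑-+ n _ _)
      where
      pascal-ℤ : ∀ j → + (suc j C suc k) ≡ + (j C k) + + (j C suc k)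
      pascal-ℤ j = trans (cong +_ (pascal j k)) (pos-+ (j C k) _)

  private
    alternatingPowerSum : ℕ → ℕ → ℤ
    alternatingPowerSum k m = ∑ m (λ j → signedBinom m j * (+ j) ^ k)

    alternatingPowerSum-suc : ∀ k m → alternatingPowerSum (suc k) (suc m)
      ≡ + suc m * alternatingPowerSum k m + + suc m * alternatingPowerSum k (suc m)
    alternatingPowerSum-suc k m = begin
      ∑ (suc m) (λ j → c′ j * (+ j * J j))
        ≡⟨ ∑-cong (suc m) (λ j → trans (split (c′ j) (+ j) M (J j))
                                       (cong (λ c → c * J j + M * (c′ j * J j)) (signedBinom-shift m j))) ⟩
      ∑ (suc m) (λ j → M * c j * J j + M * (c′ j * J j))
        ≡⟨ ∑-+ (suc m) (λ j → M * c j * J j) (λ j → M * (c′ j * J j)) ⟩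
      ∑ (suc m) (λ j → M * c j * J j) + ∑ (suc m) (λ j → M * (c′ j * J j))
        ≡⟨ cong₂ _+_ (trans (∑-cong (suc m) (λ j → *-assoc M (c j) (J j))) (∑-*ˡ (suc m) M (λ j → c j * J j)))
                     (∑-*ˡ (suc m) M (λ j → c′ j * J j)) ⟩
      M * ∑ (suc m) (λ j → c j * J j) + M * alternatingPowerSum k (suc m)
        ≡⟨ cong (λ s → M * s + M * alternatingPowerSum k (suc m)) drop-last ⟩
      M * alternatingPowerSum k m + M * alternatingPowerSum k (suc m) ∎
      where
      open ≡-Reasoning
      M = + suc m
      c c′ J : ℕ → ℤ
      c  = signedBinom m
      c′ = signedBinom (suc m)
      J j = (+ j) ^ k
      split : ∀ c j M w → c * (j * w) ≡ (c * (j - M)) * w + M * (c * w)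
      split = solve-∀
      drop-last : ∑ (suc m) (λ j → c j * J j) ≡ alternatingPowerSum k m
      drop-last = trans (∑-last m (λ j → c j * J j))
                        (trans (cong (λ z → alternatingPowerSum k m + z * J (suc m)) (signedBinom-above m))
                               (+-identityʳ _))

  stirling2-inversion : ∀ k m → + (m ! ℕ.* stirling2 k m) ≡ ∑ m (λ j → signedBinom m j * (+ j) ^ k)
  stirling2-inversion zero    zero    = refl
  stirling2-inversion zero    (suc m) = trans (cong +_ (ℕP.*-zeroʳ (suc m !))) (sym (∑-signedBinom m))
  stirling2-inversion (suc k) zero    = refl
  stirling2-inversion (suc k) (suc m) = begin
    + (suc m ! ℕ.* (S₂ k m ℕ.+ suc m ℕ.* S₂ k (suc m)))
      ≡⟨ cong +_ (spread (suc m) (m !) (S₂ k m) (S₂ k (suc m))) ⟩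
    + (suc m ℕ.* (m ! ℕ.* S₂ k m) ℕ.+ suc m ℕ.* (suc m ! ℕ.* S₂ k (suc m)))
      ≡⟨ trans (pos-+ (suc m ℕ.* (m ! ℕ.* S₂ k m)) _)
               (cong₂ _+_ (pos-* (suc m) (m ! ℕ.* S₂ k m)) (pos-* (suc m) (suc m ! ℕ.* S₂ k (suc m)))) ⟩
    + suc m * + (m ! ℕ.* S₂ k m) + + suc m * + (suc m ! ℕ.* S₂ k (suc m))
      ≡⟨ cong₂ (λ a b → + suc m * a + + suc m * b) (stirling2-inversion k m) (stirling2-inversion k (suc m)) ⟩
    + suc m * alternatingPowerSum k m + + suc m * alternatingPowerSum k (suc m)
      ≡⟨ sym (alternatingPowerSum-suc k m) ⟩
    alternatingPowerSum (suc k) (suc m) ∎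
    where
    open ≡-Reasoning
    S₂ = stirling2
    spread : ∀ M f a b → (M ℕ.* f) ℕ.* (a ℕ.+ M ℕ.* b) ≡ M ℕ.* (f ℕ.* a) ℕ.+ M ℕ.* ((M ℕ.* f) ℕ.* b)
    spread = ℕ-solve-∀

  -- Divisibility of block products of shift polynomials

  ⟦pow-Δ[]⟧-subsample : ∀ d j u x r → ⟦ pow Δ[ d ] j ⟧ u (x + + d * r) ≡ ⟦ pow Δ j ⟧ (λ r′ → u (x + + d * r′)) r
  ⟦pow-Δ[]⟧-subsample d zero    u x r = refl
  ⟦pow-Δ[]⟧-subsample d (suc j) u x r = begin
    ⟦ pow S d ⟧ W (x + + d * r) + -1ℤ * W (x + + d * r)
      ≡⟨ cong (_+ -1ℤ * W (x + + d * r)) (trans (pow-S d W (x + + d * r)) (cong W (step x (+ d) r))) ⟩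
    W (x + + d * (r - + 1)) + -1ℤ * W (x + + d * r)
      ≡⟨ cong₂ (λ a b → a + -1ℤ * b) (⟦pow-Δ[]⟧-subsample d j u x (r - + 1)) (⟦pow-Δ[]⟧-subsample d j u x r) ⟩
    W′ (r - + 1) + -1ℤ * W′ r
      ≡⟨ cong (_+ -1ℤ * W′ r) (sym (*-identityˡ (W′ (r - + 1)))) ⟩
    + 1 * W′ (r - + 1) + -1ℤ * W′ r ∎
    where
    open ≡-Reasoning
    W  = ⟦ pow Δ[ d ] j ⟧ u
    W′ = ⟦ pow Δ j ⟧ (λ r′ → u (x + + d * r′))
    step : ∀ x d r → (x + d * r) - d ≡ x + d * (r - + 1)
    step = solve-∀

  pow-Δ[]-∣ : ∀ {π} d L j → (∀ v → Periodic L v → π ∣ᶠ ⟦ pow Δ j ⟧ v) →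
              ∀ u → Periodic (d ℕ.* L) u → π ∣ᶠ ⟦ pow Δ[ d ] j ⟧ u
  pow-Δ[]-∣ {π} d L j Δʲ-∣ u u-per x =
    subst (π ∣_) (trans (sym (⟦pow-Δ[]⟧-subsample d j u x (+ 0))) (cong (⟦ pow Δ[ d ] j ⟧ u) x+d*0≡x))
          (Δʲ-∣ (λ r → u (x + + d * r)) subsample-per (+ 0))
    where
    x+d*0≡x : x + + d * + 0 ≡ x
    x+d*0≡x = trans (cong (_+_ x) (*-zeroʳ (+ d))) (+-identityʳ x)
    subsample-per : Periodic L (λ r → u (x + + d * r))
    subsample-per r =
      trans (cong u (trans (distrib x (+ d) r (+ L)) (cong (λ z → (x + + d * r) + z) (sym (pos-* d L)))))
            (u-per (x + + d * r))
      where
      distrib : ∀ x d r l → x + d * (r + l) ≡ (x + d * r) + d * l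
      distrib = solve-∀

  1∣ : ∀ x → + 1 ∣ x
  1∣ x = divides x (sym (*-identityʳ x))

  Prod-div-mod : ∀ d .{{_ : ℕ.NonZero d}} f n u x →
    ⟦ Prod f n ⟧ u x ≡ ⟦ Prod (λ i → f (d ℕ.* (n / d) ℕ.+ i)) (n % d) ⟧ (⟦ Prod f (d ℕ.* (n / d)) ⟧ u) x
  Prod-div-mod d f n u x =
    trans (cong (λ k → ⟦ Prod f k ⟧ u x) n≡d*[n/d]+n%d) (Prod-+ f (d ℕ.* (n / d)) (n % d) u x)
    where
    n≡d*[n/d]+n%d : n ≡ d ℕ.* (n / d) ℕ.+ n % d
    n≡d*[n/d]+n%d =
      trans (m≡m%n+[m/n]*n n d) (trans (ℕP.+-comm (n % d) _) (cong (ℕ._+ n % d) (ℕP.*-comm (n / d) d)))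

  -- A block is c a + π H: it adds either a factor a or a factor π, and in the
  -- hypothesis on powers of a one factor π is worth g factors a.
  module BlockProducts {π : ℤ} (d : ℕ) .{{_ : ℕ.NonZero d}} (f : ℕ → Op) {c a : Op}
    (block≈ : ∀ J → Prod (λ i → f (d ℕ.* J ℕ.+ i)) d ≈ c ⊗ a mod π)
    {L g s : ℕ} (1≤g : 1 ℕ.≤ g)
    (pow-a-∣ : ∀ T j u → Periodic L u → T ℕ.* g ℕ.+ s ℕ.≤ j → π ^ T ∣ᶠ ⟦ pow a j ⟧ u) where

    private
      B : ℕ → Op
      B J = Prod (λ i → f (d ℕ.* J ℕ.+ i)) d

    pow-Prod-∣ : ∀ K T m u → Periodic L u → T ℕ.* g ℕ.+ s ℕ.≤ m ℕ.+ K → π ^ T ∣ᶠ ⟦ pow a m ⟧ (⟦ Prod B K ⟧ u)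
    pow-Prod-∣ zero    T       m u u-per le =
      pow-a-∣ T m u u-per (subst (T ℕ.* g ℕ.+ s ℕ.≤_) (ℕP.+-identityʳ m) le)
    pow-Prod-∣ (suc K) zero    m u u-per le x = 1∣ _
    pow-Prod-∣ (suc K) (suc T) m u u-per le x = subst (π ^ suc T ∣_) (sym split) (∣m∣n⇒∣m+n c-part π-part)
      where
      W = ⟦ Prod B K ⟧ u
      H = quotient (block≈ K)
      split : ⟦ pow a m ⟧ (⟦ B K ⟧ W) x ≡ ⟦ c ⟧ (⟦ pow a (suc m) ⟧ W) x + π * ⟦ H ⟧ (⟦ pow a m ⟧ W) x
      split = begin
        ⟦ pow a m ⟧ (⟦ B K ⟧ W) x
          ≡⟨ ⟦⟧-cong (pow a m) (equality (block≈ K) W) x ⟩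
        ⟦ pow a m ⟧ (λ z → ⟦ c ⟧ (⟦ a ⟧ W) z + π * ⟦ H ⟧ W z) x
          ≡⟨ trans (⟦⟧-+ (pow a m) (⟦ c ⟧ (⟦ a ⟧ W)) (λ z → π * ⟦ H ⟧ W z) x)
                   (cong (_+_ (⟦ pow a m ⟧ (⟦ c ⟧ (⟦ a ⟧ W)) x)) (⟦⟧-* (pow a m) π (⟦ H ⟧ W) x)) ⟩
        ⟦ pow a m ⟧ (⟦ c ⟧ (⟦ a ⟧ W)) x + π * ⟦ pow a m ⟧ (⟦ H ⟧ W) x
          ≡⟨ cong₂ (λ v w → v + π * w)
                   (trans (⟦⟧-comm (pow a m) c (⟦ a ⟧ W) x) (⟦⟧-cong c (⟦⟧-comm (pow a m) a W) x))
                   (⟦⟧-comm (pow a m) H W x) ⟩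
        ⟦ c ⟧ (⟦ pow a (suc m) ⟧ W) x + π * ⟦ H ⟧ (⟦ pow a m ⟧ W) x ∎
        where open ≡-Reasoning
      le-c : suc T ℕ.* g ℕ.+ s ℕ.≤ suc m ℕ.+ K
      le-c = subst (suc T ℕ.* g ℕ.+ s ℕ.≤_) (ℕP.+-suc m K) le
      le-π : T ℕ.* g ℕ.+ s ℕ.≤ m ℕ.+ K
      le-π = ℕP.≤-pred (begin
        suc (T ℕ.* g ℕ.+ s)      ≤⟨ ℕP.+-monoˡ-≤ (T ℕ.* g ℕ.+ s) 1≤g ⟩
        g ℕ.+ (T ℕ.* g ℕ.+ s)    ≡⟨ sym (ℕP.+-assoc g (T ℕ.* g) s) ⟩
        suc T ℕ.* g ℕ.+ s        ≤⟨ le ⟩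
        m ℕ.+ suc K              ≡⟨ ℕP.+-suc m K ⟩
        suc (m ℕ.+ K)            ∎)
        where open ℕP.≤-Reasoning
      c-part : π ^ suc T ∣ ⟦ c ⟧ (⟦ pow a (suc m) ⟧ W) x
      c-part = ⟦⟧-∣ c (pow-Prod-∣ K (suc T) (suc m) u u-per le-c) x
      π-part : π ^ suc T ∣ π * ⟦ H ⟧ (⟦ pow a m ⟧ W) x
      π-part = *-monoʳ-∣ π (⟦⟧-∣ H (pow-Prod-∣ K T m u u-per le-π) x)

    Prod-∣ : ∀ T n u → Periodic L u → (T ℕ.* g ℕ.+ s) ℕ.* d ℕ.≤ n → π ^ T ∣ᶠ ⟦ Prod f n ⟧ u
    Prod-∣ T n u u-per le x = subst (π ^ T ∣_) (sym (Prod-div-mod d f n u x))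
      (⟦⟧-∣ (Prod (λ i → f (d ℕ.* (n / d) ℕ.+ i)) (n % d)) blocks-∣ x)
      where
      le′ : T ℕ.* g ℕ.+ s ℕ.≤ n / d
      le′ = subst (ℕ._≤ n / d) (m*n/n≡m (T ℕ.* g ℕ.+ s) d) (/-monoˡ-≤ d le)
      blocks-∣ : π ^ T ∣ᶠ ⟦ Prod f (d ℕ.* (n / d)) ⟧ u
      blocks-∣ z = subst (π ^ T ∣_) (sym (Prod-blocks d f (n / d) u z)) (pow-Prod-∣ (n / d) T 0 u u-per le′ z)

  𝟙 : ∀ {A : Set} → Dec A → ℤ
  𝟙 (yes _) = + 1
  𝟙 (no _)  = + 0

  𝟙-⇔ : ∀ {A B : Set} (A? : Dec A) (B? : Dec B) → (A → B) → (B → A) → 𝟙 A? ≡ 𝟙 B?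
  𝟙-⇔ (yes _) (yes _) A→B B→A = refl
  𝟙-⇔ (yes a) (no ¬b) A→B B→A = contradiction (A→B a) ¬b
  𝟙-⇔ (no ¬a) (yes b) A→B B→A = contradiction (B→A b) ¬a
  𝟙-⇔ (no _)  (no _)  A→B B→A = refl

  *-^ : ∀ x y k → (x * y) ^ k ≡ x ^ k * y ^ k
  *-^ x y zero    = refl
  *-^ x y (suc k) = trans (cong ((x * y) *_) (*-^ x y k)) (interchange x y (x ^ k) (y ^ k))
    where
    interchange : ∀ x y a b → (x * y) * (a * b) ≡ (x * a) * (y * b)
    interchange = solve-∀

  pos-^ : ∀ m k → + (m ℕ.^ k) ≡ (+ m) ^ k
  pos-^ m zero    = refl
  pos-^ m (suc k) = trans (pos-* m (m ℕ.^ k)) (cong (_*_ (+ m)) (pos-^ m k))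

  -- stirSum is a sumTo over a with-function local to its definition; this names that function.
  summand : ∀ n (x : ℤ) {f} → x ≡ sumTo n f → ℕ → ℤ
  summand _ _ {f} _ = f

  module StirlingSum (n m M : ℕ) (a r : ℤ) where

    indicator : Fun
    indicator z = 𝟙 (M ℕD.∣? ∣ z ∣)

    indicator-periodic : Periodic M indicator
    indicator-periodic z = 𝟙-⇔ (M ℕD.∣? ∣ z + + M ∣) (M ℕD.∣? ∣ z ∣)
      (λ M∣z+M → ∣⇒∣ᵤ (∣m+n∣n⇒∣m {+ M} {z} (∣ᵤ⇒∣ {+ M} {z + + M} M∣z+M) ∣-refl))
      (λ M∣z → ∣⇒∣ᵤ {+ M} {z + + M} (∣m∣n⇒∣m+n (∣ᵤ⇒∣ {+ M} {z} M∣z) ∣-refl))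

    coefficient : ℕ → ℤ
    coefficient k = + (stirling1 n k ℕ.* stirling2 k m) * a ^ k

    summand≡ : ∀ k → summand n (stirSum n m M a r) refl k ≡ coefficient k * 𝟙 (M ℕD.∣? ∣ + k - r ∣)
    summand≡ k with M ℕD.∣? ∣ + k - r ∣
    ... | yes _ = sym (*-identityʳ (coefficient k))
    ... | no  _ = sym (*-zeroʳ (coefficient k))

    stirSum≡∑ : stirSum n m M a r ≡ ∑ n (λ k → coefficient k * indicator (r - + k))
    stirSum≡∑ = trans (sumTo≡∑ n (summand n (stirSum n m M a r) refl))
      (∑-cong n (λ k → trans (summand≡ k) (cong (λ z → coefficient k * 𝟙 (M ℕD.∣? z)) (∣i-j∣≡∣j-i∣ (+ k) r))))

    m!*coefficient : ∀ k → + (m !) * coefficient k ≡ ∑ m (λ j → signedBinom m j * (s₁ n k * (+ j * a) ^ k))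
    m!*coefficient k = begin
      + (m !) * (+ (stirling1 n k ℕ.* stirling2 k m) * a ^ k)
        ≡⟨ cong (λ c → + (m !) * (c * a ^ k)) (pos-* (stirling1 n k) (stirling2 k m)) ⟩
      + (m !) * (s₁ n k * + stirling2 k m * a ^ k)
        ≡⟨ regroup (+ (m !)) (s₁ n k) (+ stirling2 k m) (a ^ k) ⟩
      + (m !) * + stirling2 k m * (s₁ n k * a ^ k)
        ≡⟨ cong (_* (s₁ n k * a ^ k)) (trans (sym (pos-* (m !) (stirling2 k m))) (stirling2-inversion k m)) ⟩
      ∑ m (λ j → signedBinom m j * (+ j) ^ k) * (s₁ n k * a ^ k)
        ≡⟨ trans (*-comm _ (s₁ n k * a ^ k)) (sym (∑-*ˡ m (s₁ n k * a ^ k) (λ j → signedBinom m j * (+ j) ^ k))) ⟩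
      ∑ m (λ j → s₁ n k * a ^ k * (signedBinom m j * (+ j) ^ k))
        ≡⟨ ∑-cong m (λ j → trans (rearrange (s₁ n k) (a ^ k) (signedBinom m j) ((+ j) ^ k))
                                 (cong (λ z → signedBinom m j * (s₁ n k * z)) (sym (*-^ (+ j) a k)))) ⟩
      ∑ m (λ j → signedBinom m j * (s₁ n k * (+ j * a) ^ k)) ∎
      where
      open ≡-Reasoning
      regroup : ∀ f s S x → f * (s * S * x) ≡ f * S * (s * x)
      regroup = solve-∀
      rearrange : ∀ s x c y → s * x * (c * y) ≡ c * (s * (y * x))
      rearrange = solve-∀

    m!*stirSum≡ : + (m !) * stirSum n m M a r ≡
                  ∑ m (λ j → signedBinom m j * ∑ n (λ k → s₁ n k * (+ j * a) ^ k * indicator (r - + k)))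
    m!*stirSum≡ = begin
      + (m !) * stirSum n m M a r
        ≡⟨ cong (+ (m !) *_) stirSum≡∑ ⟩
      + (m !) * ∑ n (λ k → coefficient k * indicator (r - + k))
        ≡⟨ sym (∑-*ˡ n (+ (m !)) _) ⟩
      ∑ n (λ k → + (m !) * (coefficient k * indicator (r - + k)))
        ≡⟨ ∑-cong n (λ k → trans (sym (*-assoc (+ (m !)) (coefficient k) _))
                                 (trans (cong (_* indicator (r - + k)) (m!*coefficient k)) (∑-*ʳ k))) ⟩
      ∑ n (λ k → ∑ m (λ j → signedBinom m j * (s₁ n k * (+ j * a) ^ k) * indicator (r - + k)))
        ≡⟨ ∑-comm n m _ ⟩
      ∑ m (λ j → ∑ n (λ k → signedBinom m j * (s₁ n k * (+ j * a) ^ k) * indicator (r - + k)))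
        ≡⟨ ∑-cong m (λ j → trans (∑-cong n (λ k → *-assoc (signedBinom m j) _ _)) (∑-*ˡ n (signedBinom m j) _)) ⟩
      ∑ m (λ j → signedBinom m j * ∑ n (λ k → s₁ n k * (+ j * a) ^ k * indicator (r - + k))) ∎
      where
      open ≡-Reasoning
      ∑-*ʳ : ∀ k → ∑ m (λ j → signedBinom m j * (s₁ n k * (+ j * a) ^ k)) * indicator (r - + k)
                 ≡ ∑ m (λ j → signedBinom m j * (s₁ n k * (+ j * a) ^ k) * indicator (r - + k))
      ∑-*ʳ k = trans (*-comm _ (indicator (r - + k)))
                     (trans (sym (∑-*ˡ m (indicator (r - + k)) _))
                            (∑-cong m (λ j → *-comm (indicator (r - + k)) _)))

  prime-power-∣-cancel : ∀ {p w y} i → Prime p → ¬ p ℕD.∣ w → p ℕ.^ i ℕD.∣ w ℕ.* y → p ℕ.^ i ℕD.∣ y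
  prime-power-∣-cancel         zero    _     _   _ = ℕD.1∣ _
  prime-power-∣-cancel {p} {w} (suc i) p-prime p∤w h
    with euclidsLemma w _ p-prime (ℕD.∣-trans (ℕD.m∣m*n (p ℕ.^ i)) h)
  ... | inj₁ p∣w = contradiction p∣w p∤w
  ... | inj₂ (ℕD.divides y′ refl) = subst (ℕD._∣ y′ ℕ.* p) (ℕP.*-comm (p ℕ.^ i) p)
    (ℕD.*-monoˡ-∣ p (prime-power-∣-cancel i p-prime p∤w (ℕD.*-cancelʳ-∣ p p^i*p∣w*y′*p)))
    where
    instance _ = prime⇒nonZero p-prime
    p^i*p∣w*y′*p : p ℕ.^ i ℕ.* p ℕD.∣ w ℕ.* y′ ℕ.* p
    p^i*p∣w*y′*p = subst₂ ℕD._∣_ (ℕP.*-comm p (p ℕ.^ i)) (sym (ℕP.*-assoc w y′ p)) h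

  IsOrd-∣-cancel : ∀ {p c e y} i → Prime p → IsOrd p c e → p ℕ.^ (i ℕ.+ e) ℕD.∣ c ℕ.* y → p ℕ.^ i ℕD.∣ y
  IsOrd-∣-cancel {p} {c} {e} {y} i p-prime (ℕD.divides w refl , p^1+e∤c) h =
    prime-power-∣-cancel i p-prime p∤w
      (ℕD.*-cancelʳ-∣ (p ℕ.^ e) (subst₂ ℕD._∣_ (ℕP.^-distribˡ-+-* p i e) (swap w (p ℕ.^ e) y) h))
    where
    instance _ = prime⇒nonZero p-prime
    instance _ = ℕP.m^n≢0 p e
    p∤w : ¬ p ℕD.∣ w
    p∤w (ℕD.divides v refl) = p^1+e∤c (ℕD.divides v (ℕP.*-assoc v p (p ℕ.^ e)))
    swap : ∀ w P y → w ℕ.* P ℕ.* y ≡ w ℕ.* y ℕ.* P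
    swap = ℕ-solve-∀

  floorDiv-≤ : ∀ x M T → 1 ℕ.≤ M → + T ≤ floorDiv x M → + (T ℕ.* M) ≤ x
  floorDiv-≤ x (suc d) T _ T≤x/M =
    ≤-trans (≤-reflexive (pos-* T (suc d))) (≤-trans (*-monoʳ-≤-nonNeg (+ suc d) T≤x/M) ([n/ℕd]*d≤n x (suc d)))

  ≤-floorDiv : ∀ n P M i e → 1 ℕ.≤ M → + i ≤ floorDiv (+ n - + P) M - + e → (i ℕ.+ e) ℕ.* M ℕ.+ P ℕ.≤ n
  ≤-floorDiv n P M i e 1≤M i≤F-e = drop‿+≤+ (begin
    + ((i ℕ.+ e) ℕ.* M ℕ.+ P)       ≡⟨ pos-+ ((i ℕ.+ e) ℕ.* M) P ⟩
    + ((i ℕ.+ e) ℕ.* M) + + P       ≤⟨ +-monoˡ-≤ (+ P) (floorDiv-≤ (+ n - + P) M (i ℕ.+ e) 1≤M i+e≤F) ⟩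
    + n - + P + + P                 ≡⟨ sub-add (+ n) (+ P) ⟩
    + n                             ∎)
    where
    open ≤-Reasoning
    sub-add : ∀ a b → a - b + b ≡ a
    sub-add = solve-∀
    i+e≤F : + (i ℕ.+ e) ≤ floorDiv (+ n - + P) M
    i+e≤F = ≤-trans (≤-reflexive (pos-+ i e))
                    (≤-trans (+-monoˡ-≤ (+ e) i≤F-e) (≤-reflexive (sub-add (floorDiv (+ n - + P) M) (+ e))))

  -- Congruences modulo a prime

  downward-induction : ∀ (P : ℕ → Set) N → (∀ m → m ℕ.≤ N → (∀ j → m ℕ.< j → j ℕ.≤ N → P j) → P m) →
                       ∀ m → m ℕ.≤ N → P m
  downward-induction P N step m m≤N = above (N ℕ.∸ m) m (ℕP.m∸n+n≡m m≤N) m ℕP.≤-refl m≤N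
    where
    above : ∀ d m → d ℕ.+ m ≡ N → ∀ j → m ℕ.≤ j → j ℕ.≤ N → P j
    above zero    m refl j m≤j j≤N = step j j≤N (λ i j<i i≤N → contradiction (ℕP.≤-trans i≤N m≤j) (ℕP.<⇒≱ j<i))
    above (suc d) m eq   j m≤j j≤N with ℕP.m≤n⇒m<n∨m≡n m≤j
    ... | inj₁ m<j  = above d (suc m) (trans (ℕP.+-suc d m) eq) j m<j j≤N
    ... | inj₂ refl = step j j≤N (λ i j<i i≤N → above d (suc j) (trans (ℕP.+-suc d j) eq) i j<i i≤N)

  -- p is written 2 + q, so that p - 1 = suc q holds definitionally.
  module ModPrime (q : ℕ) (p-prime : Prime (2+ q)) where

    p : ℕ
    p = 2+ q

    π : ℤ
    π = + p

    π∣0 : π ∣ + 0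
    π∣0 = divides (+ 0) refl

    π∣m*x⇒π∣x : ∀ m x → ¬ p ℕD.∣ m → π ∣ + m * x → π ∣ x
    π∣m*x⇒π∣x m x p∤m π∣mx with euclidsLemma m ∣ x ∣ p-prime (subst (p ℕD.∣_) (abs-* (+ m) x) (∣⇒∣ᵤ π∣mx))
    ... | inj₁ p∣m = contradiction p∣m p∤m
    ... | inj₂ p∣x = ∣ᵤ⇒∣ p∣x

    p∤ : ∀ {j} → 0 ℕ.< j → j ℕ.< p → ¬ p ℕD.∣ j
    p∤ {suc j} _ j<p p∣j = ℕP.<⇒≱ j<p (ℕD.∣⇒≤ p∣j)

    π∣pCj : ∀ {j} → 0 ℕ.< j → j ℕ.< p → π ∣ + (p C j)
    π∣pCj {suc j} 0<j j<p = π∣m*x⇒π∣x (suc j) (+ (p C suc j)) (p∤ 0<j j<p) (divides (+ (suc q C j)) absorb)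
      where
      absorb : + suc j * + (p C suc j) ≡ + (suc q C j) * π
      absorb = trans (sym (pos-* (suc j) (p C suc j)))
                     (trans (cong +_ (C-absorb (suc q) j))
                            (trans (pos-* p (suc q C j)) (*-comm π (+ (suc q C j)))))

    [p-1]Cj≡-1^j : ∀ j → j ℕ.≤ suc q → π ∣ + (suc q C j) - -1ℤ ^ j
    [p-1]Cj≡-1^j zero    _     = π∣0
    [p-1]Cj≡-1^j (suc j) j<p-1 = subst (π ∣_) pascal-step
      (∣m∣n⇒∣m-n (π∣pCj (ℕ.s≤s ℕ.z≤n) (ℕ.s≤s j<p-1)) ([p-1]Cj≡-1^j j (ℕP.<⇒≤ j<p-1)))
      where
      cancel : ∀ a b s → (a + b) - (a - s) ≡ b - -1ℤ * s
      cancel = solve-∀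
      pascal-step : + (p C suc j) - (+ (suc q C j) - -1ℤ ^ j) ≡ + (suc q C suc j) - -1ℤ ^ suc j
      pascal-step =
        trans (cong (λ c → c - (+ (suc q C j) - -1ℤ ^ j))
                    (trans (cong +_ (pascal (suc q) j)) (pos-+ (suc q C j) (suc q C suc j))))
              (cancel (+ (suc q C j)) (+ (suc q C suc j)) (-1ℤ ^ j))

    -1^[p-1]≡1 : π ∣ -1ℤ ^ suc q - + 1
    -1^[p-1]≡1 = subst (π ∣_) (trans (cong (λ c → - (+ c - t)) (nCn≡1 (suc q))) (flip t))
                       (∣m⇒∣-m ([p-1]Cj≡-1^j (suc q) ℕP.≤-refl))
      where
      t = -1ℤ ^ suc q
      flip : ∀ t → - (+ 1 - t) ≡ t - + 1
      flip = solve-∀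

    signedBinom[p-1,j]≡1 : ∀ j → j ℕ.≤ suc q → π ∣ signedBinom (suc q) j - + 1
    signedBinom[p-1,j]≡1 j j≤p-1 = subst (π ∣_) eq (∣m∣n⇒∣m+n (∣n⇒∣m*n (t * s) ([p-1]Cj≡-1^j j j≤p-1)) -1^[p-1]≡1)
      where
      open ≡-Reasoning
      t = -1ℤ ^ suc q
      s = -1ℤ ^ j
      c = + (suc q C j)
      expand : ∀ t s c → (t * s) * (c - s) + (t - + 1) ≡ (t * s) * c - t * (s * s) + t - + 1
      expand = solve-∀
      collapse : ∀ t s c → (t * s) * c - t * + 1 + t - + 1 ≡ (t * s) * c - + 1
      collapse = solve-∀
      eq : (t * s) * (c - s) + (t - + 1) ≡ signedBinom (suc q) j - + 1
      eq = begin
        (t * s) * (c - s) + (t - + 1)           ≡⟨ expand t s c ⟩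
        (t * s) * c - t * (s * s) + t - + 1     ≡⟨ cong (λ z → (t * s) * c - t * z + t - + 1) (-1^n*-1^n≡1 j) ⟩
        (t * s) * c - t * + 1 + t - + 1         ≡⟨ collapse t s c ⟩
        (t * s) * c - + 1                       ≡⟨ cong (λ z → z * c - + 1) (sym (^-distribˡ-+-* -1ℤ (suc q) j)) ⟩
        signedBinom (suc q) j - + 1             ∎

    signedBinom[p,j]≡δ : ∀ j → j ℕ.≤ p → π ∣ signedBinom p j - (δ p j - δ 0 j)
    signedBinom[p,j]≡δ zero _ rewrite ℕP.+-identityʳ q = subst (π ∣_) (flip (-1ℤ ^ suc q)) (∣m⇒∣-m -1^[p-1]≡1)
      where
      flip : ∀ t → - (t - + 1) ≡ -1ℤ * t * + 1 - (+ 0 - + 1)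
      flip = solve-∀
    signedBinom[p,j]≡δ (suc j) j<p with ℕP.m≤n⇒m<n∨m≡n j<p
    ... | inj₁ (ℕ.s≤s j<p-1) rewrite δ-≢ {suc q} {j} (ℕP.<⇒≢ j<p-1 ∘ sym) =
      subst (π ∣_) (sym (+-identityʳ _)) (∣n⇒∣m*n (-1ℤ ^ (p ℕ.+ suc j)) (π∣pCj (ℕ.s≤s ℕ.z≤n) (ℕ.s≤s j<p-1)))
    ... | inj₂ refl rewrite ^-distribˡ-+-* -1ℤ p p | -1^n*-1^n≡1 p | nCn≡1 p | δ-refl (suc q) = π∣0

    pow-Δ≈∑S^k : pow Δ (suc q) ≈ poly (λ _ → + 1) (suc q) mod π
    pow-Δ≈∑S^k =
      ≈-trans (pow-Δ≈poly (suc q)) (poly-cong (suc q) (signedBinom (suc q)) (λ _ → + 1) signedBinom[p-1,j]≡1)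

    pow-Δ≈Δ[p] : pow Δ p ≈ I ⊗ Δ[ p ] mod π
    pow-Δ≈Δ[p] = ≈-trans (pow-Δ≈poly p)
      (≈-trans (poly-cong p (signedBinom p) (λ k → δ p k - δ 0 k) signedBinom[p,j]≡δ)
               (≈-reflexive _ (I ⊗ Δ[ p ]) evaluate))
      where
      evaluate : ∀ u x → ⟦ poly (λ k → δ p k - δ 0 k) p ⟧ u x ≡ ⟦ Δ[ p ] ⟧ u x
      evaluate u x = begin
        ⟦ poly (λ k → δ p k - δ 0 k) p ⟧ u x              ≡⟨ ⟦poly⟧ (λ k → δ p k - δ 0 k) p u x ⟩
        ∑ p (λ k → (δ p k - δ 0 k) * u (x - + k))         ≡⟨ ∑-δ-δ p p 0 (λ k → u (x - + k)) ℕP.≤-refl ℕ.z≤n ⟩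
        u (x - + p) - u (x - + 0)                         ≡⟨ cong (λ z → u (x - + p) - u z) (+-identityʳ x) ⟩
        u (x - + p) - u x                                 ≡⟨ sym (⟦Δ[]⟧ p u x) ⟩
        ⟦ Δ[ p ] ⟧ u x                                    ∎
        where open ≡-Reasoning

    s₁[p,1+k]-step : ∀ k → 1 ℕ.≤ k → suc k ℕ.≤ suc q → (∀ j → suc k ℕ.< j → j ℕ.≤ suc q → π ∣ s₁ p j) →
                     π ∣ s₁ p (suc k)
    s₁[p,1+k]-step k 1≤k m≤p-1 π∣above = π∣m*x⇒π∣x m (s₁ p m) (p∤ (ℕ.s≤s ℕ.z≤n) (ℕ.s≤s m≤p-1)) π∣m*s
      where
      m = suc k
      m≤p : m ℕ.≤ p
      m≤p = ℕP.≤-trans m≤p-1 (ℕP.n≤1+n (suc q))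
      k<p : k ℕ.< p
      k<p = ℕP.<-≤-trans (ℕP.n<1+n k) m≤p
      f g : ℕ → ℤ
      f j = s₁ p j * + (j C k)
      g j = δ k j * s₁ p k + δ m j * (+ m * s₁ p m)
      vanish : ∀ a b c → a * + 0 - (+ 0 * b + + 0 * c) ≡ + 0
      vanish = solve-∀
      diagonal : ∀ a c → a * + 1 - (+ 1 * a + + 0 * c) ≡ + 0
      diagonal = solve-∀
      next : ∀ a b m → a * m - (+ 0 * b + + 1 * (m * a)) ≡ + 0
      next = solve-∀
      f≡g : ∀ j → j ℕ.≤ p → π ∣ f j - g j
      f≡g j j≤p with ℕP.<-cmp j k
      ... | tri< j<k _ _
        rewrite k>n⇒nCk≡0 j<k | δ-≢ {k} {j} (ℕP.<⇒≢ j<k ∘ sym) | δ-≢ {m} {j} (ℕP.<⇒≢ (ℕP.m<n⇒m<1+n j<k) ∘ sym)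
        = subst (π ∣_) (sym (vanish (s₁ p j) (s₁ p k) (+ m * s₁ p m))) π∣0
      ... | tri≈ _ refl _ rewrite nCn≡1 j | δ-refl j | δ-≢ {m} {j} ℕP.1+n≢n
        = subst (π ∣_) (sym (diagonal (s₁ p j) (+ m * s₁ p m))) π∣0
      ... | tri> _ _ k<j with ℕP.m≤n⇒m<n∨m≡n k<j
      ...   | inj₂ refl rewrite [1+n]Cn≡1+n k | δ-≢ {k} {m} (ℕP.1+n≢n ∘ sym) | δ-refl k
        = subst (π ∣_) (sym (next (s₁ p m) (s₁ p k) (+ m))) π∣0
      ...   | inj₁ m<j rewrite δ-≢ {k} {j} (ℕP.<⇒≢ k<j) | δ-≢ {m} {j} (ℕP.<⇒≢ m<j) with ℕP.m≤n⇒m<n∨m≡n j≤p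
      ...     | inj₁ j<p  = subst (π ∣_) (sym (+-identityʳ _)) (∣m⇒∣m*n (+ (j C k)) (π∣above j m<j (ℕP.≤-pred j<p)))
      ...     | inj₂ refl = subst (π ∣_) (sym (+-identityʳ _)) (∣n⇒∣m*n (s₁ p p) (π∣pCj 1≤k k<p))
      ∑f : ∑ p f ≡ s₁ p k + π * s₁ p m
      ∑f = trans (sym (s₁-binomial p k)) (s₁-suc-suc p k)
      ∑g : ∑ p g ≡ s₁ p k + + m * s₁ p m
      ∑g = trans (∑-+ p (λ j → δ k j * s₁ p k) (λ j → δ m j * (+ m * s₁ p m)))
                 (cong₂ _+_ (∑-δ p k (λ _ → s₁ p k) (ℕP.<⇒≤ k<p)) (∑-δ p m (λ _ → + m * s₁ p m) m≤p))
      cancel : ∀ a π m s → π * s - ((a + π * s) - (a + m * s)) ≡ m * s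
      cancel = solve-∀
      π∣m*s : π ∣ + m * s₁ p m
      π∣m*s = subst (π ∣_) (cancel (s₁ p k) π (+ m) (s₁ p m))
        (∣m∣n⇒∣m-n (∣m⇒∣m*n (s₁ p m) ∣-refl) (subst (π ∣_) (cong₂ _-_ ∑f ∑g) (∑-cong-mod p f g f≡g)))

    π∣s₁[p,j] : ∀ j → 2 ℕ.≤ j → j ℕ.≤ suc q → π ∣ s₁ p j
    π∣s₁[p,j] j 2≤j j≤p-1 = downward-induction (λ j → 2 ℕ.≤ j → π ∣ s₁ p j) (suc q) step j j≤p-1 2≤j
      where
      step : ∀ m → m ℕ.≤ suc q → (∀ j → m ℕ.< j → j ℕ.≤ suc q → 2 ℕ.≤ j → π ∣ s₁ p j) → 2 ℕ.≤ m → π ∣ s₁ p m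
      step (suc k) m≤p-1 π∣above (ℕ.s≤s 1≤k) =
        s₁[p,1+k]-step k 1≤k m≤p-1 (λ j m<j j≤p-1 → π∣above j m<j j≤p-1 (ℕP.≤-trans (ℕ.s≤s 1≤k) (ℕP.<⇒≤ m<j)))

    s₁[p,k]≡δ : ∀ k → k ℕ.≤ p → π ∣ s₁ p k - (δ p k + δ 1 k * s₁ p 1)
    s₁[p,k]≡δ zero         _ rewrite stirling1-suc-0 (suc q) = π∣0
    s₁[p,k]≡δ (suc zero)   _ = subst (π ∣_) (sym (cancel (s₁ p 1))) π∣0
      where
      cancel : ∀ s → s - (+ 0 + + 1 * s) ≡ + 0
      cancel = solve-∀
    s₁[p,k]≡δ (2+ k) k≤p with ℕP.m≤n⇒m<n∨m≡n k≤p
    ... | inj₁ (ℕ.s≤s (ℕ.s≤s k<q)) rewrite δ-≢ {q} {k} (ℕP.<⇒≢ k<q ∘ sym) =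
      subst (π ∣_) (sym (+-identityʳ _)) (π∣s₁[p,j] (2+ k) (ℕ.s≤s (ℕ.s≤s ℕ.z≤n)) (ℕ.s≤s k<q))
    ... | inj₂ refl rewrite stirling1-diag p | δ-refl q = π∣0

    π∣rising : ∀ y → π ∣ rising y p
    π∣rising y = rising-∣ p (n%ℕd<d (- y) p) π∣y+i
      where
      i = (- y) %ℕ p
      t = (- y) /ℕ p
      π∣y+i : π ∣ y + + i
      π∣y+i = divides (- t) (begin
        y + + i                      ≡⟨ cong (_+_ y) (add-sub (+ i) (t * π)) ⟩
        y + ((+ i + t * π) - t * π)  ≡⟨ cong (λ z → y + (z - t * π)) (sym (a≡a%ℕn+[a/ℕn]*n (- y) p)) ⟩
        y + (- y - t * π)            ≡⟨ cancel y t π ⟩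
        - t * π                      ∎)
        where
        open ≡-Reasoning
        add-sub : ∀ a b → a ≡ (a + b) - b
        add-sub = solve-∀
        cancel : ∀ y t π → y + (- y - t * π) ≡ - t * π
        cancel = solve-∀
      rising-∣ : ∀ n → i ℕ.< n → π ∣ y + + i → π ∣ rising y n
      rising-∣ (suc n) i<1+n π∣y+i with ℕP.m≤n⇒m<n∨m≡n (ℕP.≤-pred i<1+n)
      ... | inj₁ i<n  = ∣n⇒∣m*n (y + + n) (rising-∣ n i<n π∣y+i)
      ... | inj₂ refl = ∣m⇒∣m*n (rising y n) π∣y+i

    π∣y^p+s₁[p,1]y : ∀ y → π ∣ y ^ p + s₁ p 1 * y ^ 1
    π∣y^p+s₁[p,1]y y = subst (π ∣_) (trans (cancel (∑ p F) (∑ p E)) ∑E)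
      (∣m∣n⇒∣m-n (subst (π ∣_) (rising-expansion y p) (π∣rising y)) (∑-cong-mod p F E F≡E))
      where
      e : ℕ → ℤ
      e k = δ p k + δ 1 k * s₁ p 1
      F E : ℕ → ℤ
      F k = s₁ p k * y ^ k
      E k = e k * y ^ k
      *-distribʳ-- : ∀ a b c → a * c - b * c ≡ (a - b) * c
      *-distribʳ-- = solve-∀
      F≡E : ∀ k → k ℕ.≤ p → π ∣ F k - E k
      F≡E k k≤p = subst (π ∣_) (sym (*-distribʳ-- (s₁ p k) (e k) (y ^ k))) (∣m⇒∣m*n (y ^ k) (s₁[p,k]≡δ k k≤p))
      cancel : ∀ a b → a - (a - b) ≡ b
      cancel = solve-∀
      distribute : ∀ a b s w → (a + b * s) * w ≡ a * w + b * (s * w)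
      distribute = solve-∀
      ∑E : ∑ p E ≡ y ^ p + s₁ p 1 * y ^ 1
      ∑E = trans (∑-cong p (λ k → distribute (δ p k) (δ 1 k) (s₁ p 1) (y ^ k)))
                 (trans (∑-+ p (λ k → δ p k * y ^ k) (λ k → δ 1 k * (s₁ p 1 * y ^ k)))
                        (cong₂ _+_ (∑-δ p p (y ^_) ℕP.≤-refl) (∑-δ p 1 (λ k → s₁ p 1 * y ^ k) (ℕ.s≤s ℕ.z≤n))))

    s₁[p,k]y^k≡ : ∀ y k → k ℕ.≤ p → π ∣ s₁ p k * y ^ k - (δ p k - δ 1 k) * y ^ p
    s₁[p,k]y^k≡ y k k≤p = subst (π ∣_) eq
      (∣m∣n⇒∣m+n (∣m⇒∣m*n (y ^ k) (s₁[p,k]≡δ k k≤p)) (∣n⇒∣m*n (δ 1 k) (π∣y^p+s₁[p,1]y y)))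
      where
      open ≡-Reasoning
      s = s₁ p 1
      expand : ∀ a b c s w v x →
        (a - (b + c * s)) * w + c * (v + s * x) ≡ a * w - b * w - c * (s * w) + c * v + c * (s * x)
      expand = solve-∀
      collapse : ∀ a b c s w v x → a * w - b * v - c * (s * x) + c * v + c * (s * x) ≡ a * w - (b - c) * v
      collapse = solve-∀
      eq : (s₁ p k - (δ p k + δ 1 k * s)) * y ^ k + δ 1 k * (y ^ p + s * y ^ 1)
         ≡ s₁ p k * y ^ k - (δ p k - δ 1 k) * y ^ p
      eq = begin
        (s₁ p k - (δ p k + δ 1 k * s)) * y ^ k + δ 1 k * (y ^ p + s * y ^ 1)
          ≡⟨ expand (s₁ p k) (δ p k) (δ 1 k) s (y ^ k) (y ^ p) (y ^ 1) ⟩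
        s₁ p k * y ^ k - δ p k * y ^ k - δ 1 k * (s * y ^ k) + δ 1 k * y ^ p + δ 1 k * (s * y ^ 1)
          ≡⟨ cong₂ (λ a b → s₁ p k * y ^ k - a - b + δ 1 k * y ^ p + δ 1 k * (s * y ^ 1))
                   (δ-* p k (y ^_)) (δ-* 1 k (λ i → s * y ^ i)) ⟩
        s₁ p k * y ^ k - δ p k * y ^ p - δ 1 k * (s * y ^ 1) + δ 1 k * y ^ p + δ 1 k * (s * y ^ 1)
          ≡⟨ collapse (s₁ p k) (δ p k) (δ 1 k) s (y ^ k) (y ^ p) (y ^ 1) ⟩
        s₁ p k * y ^ k - (δ p k - δ 1 k) * y ^ p ∎

    rising-block≈ : ∀ y J → Prod (λ i → Rising.factor y (p ℕ.* J ℕ.+ i)) p ≈ scalar (y ^ p) ⊗ S ⊗ Δ[ suc q ] mod π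
    rising-block≈ y J = ≈-trans reduce-factors (≈-trans expand (≈-trans reduce-coefficients collapse))
      where
      open Rising y
      open ≡-Reasoning
      Y = y ^ p
      shift : ∀ i → + (p ℕ.* J ℕ.+ i) - + i ≡ + J * π
      shift i = begin
        + (p ℕ.* J ℕ.+ i) - + i     ≡⟨ cong (_- + i) (pos-+ (p ℕ.* J) i) ⟩
        + (p ℕ.* J) + + i - + i     ≡⟨ add-sub (+ (p ℕ.* J)) (+ i) ⟩
        + (p ℕ.* J)                 ≡⟨ pos-* p J ⟩
        π * + J                     ≡⟨ *-comm π (+ J) ⟩
        + J * π                     ∎
        where
        add-sub : ∀ a b → a + b - b ≡ a
        add-sub = solve-∀
      evaluate : ∀ u x → ⟦ poly (λ k → (δ p k - δ 1 k) * Y) p ⟧ u x ≡ Y * ⟦ Δ[ suc q ] ⟧ u (x - + 1)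
      evaluate u x = begin
        ⟦ poly (λ k → (δ p k - δ 1 k) * Y) p ⟧ u x
          ≡⟨ ⟦poly⟧ (λ k → (δ p k - δ 1 k) * Y) p u x ⟩
        ∑ p (λ k → (δ p k - δ 1 k) * Y * u (x - + k))
          ≡⟨ ∑-cong p (λ k → *-assoc (δ p k - δ 1 k) Y (u (x - + k))) ⟩
        ∑ p (λ k → (δ p k - δ 1 k) * (Y * u (x - + k)))
          ≡⟨ ∑-δ-δ p p 1 (λ k → Y * u (x - + k)) ℕP.≤-refl (ℕ.s≤s ℕ.z≤n) ⟩
        Y * u (x - + p) - Y * u (x - + 1)
          ≡⟨ cong (λ z → Y * u z - Y * u (x - + 1)) (sym (shift-by x (+ suc q))) ⟩
        Y * u ((x - + 1) - + suc q) - Y * u (x - + 1)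
          ≡⟨ sym (*-distribˡ-- Y (u ((x - + 1) - + suc q)) (u (x - + 1))) ⟩
        Y * (u ((x - + 1) - + suc q) - u (x - + 1))
          ≡⟨ cong (Y *_) (sym (⟦Δ[]⟧ (suc q) u (x - + 1))) ⟩
        Y * ⟦ Δ[ suc q ] ⟧ u (x - + 1) ∎
        where
        shift-by : ∀ x k → (x - + 1) - k ≡ x - (+ 1 + k)
        shift-by = solve-∀
        *-distribˡ-- : ∀ a b c → a * (b - c) ≡ a * b - a * c
        *-distribˡ-- = solve-∀
      reduce-factors : Prod (λ i → factor (p ℕ.* J ℕ.+ i)) p ≈ Prod factor p mod π
      reduce-factors = Prod-cong (λ i → factor (p ℕ.* J ℕ.+ i)) factor p (λ i →
        ⊕-cong (≈-refl (scalar y ⊗ S)) (scalar-cong (+ (p ℕ.* J ℕ.+ i)) (+ i) (divides (+ J) (shift i))))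
      expand : Prod factor p ≈ poly (λ k → s₁ p k * y ^ k) p mod π
      expand = ≈-reflexive (Prod factor p) (poly (λ k → s₁ p k * y ^ k) p)
        (λ u x → trans (⟦Prod-factor⟧ p u x) (sym (⟦poly⟧ (λ k → s₁ p k * y ^ k) p u x)))
      reduce-coefficients : poly (λ k → s₁ p k * y ^ k) p ≈ poly (λ k → (δ p k - δ 1 k) * Y) p mod π
      reduce-coefficients = poly-cong p (λ k → s₁ p k * y ^ k) (λ k → (δ p k - δ 1 k) * Y) (s₁[p,k]y^k≡ y)
      collapse : poly (λ k → (δ p k - δ 1 k) * Y) p ≈ scalar Y ⊗ S ⊗ Δ[ suc q ] mod π
      collapse = ≈-reflexive (poly (λ k → (δ p k - δ 1 k) * Y) p) (scalar Y ⊗ S ⊗ Δ[ suc q ]) evaluate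

    -- p-adic divisibility of iterated differences

    1≤p^β*[p-1] : ∀ β → 1 ℕ.≤ p ℕ.^ β ℕ.* suc q
    1≤p^β*[p-1] β = ℕP.*-mono-≤ (ℕP.m^n>0 p β) (ℕ.s≤s ℕ.z≤n)

    -- Fleck: (S - 1)ᵖ⁻¹ ≡ 1 + S + ⋯ + Sᵖ⁻¹, which kills (S - 1) u for p-periodic u.
    pow-Δ-∣-Fleck : ∀ T j u → Periodic p u → T ℕ.* suc q ℕ.≤ j → π ^ T ∣ᶠ ⟦ pow Δ (suc j) ⟧ u
    pow-Δ-∣-Fleck zero    j u u-per le x = 1∣ _
    pow-Δ-∣-Fleck (suc T) j u u-per le x with ℕP.m≤n⇒∃[o]m+o≡n le
    ... | o , refl = subst (π ^ suc T ∣_) (sym split)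
                           (*-monoʳ-∣ π (⟦⟧-∣ H (pow-Δ-∣-Fleck T j′ u u-per (ℕP.m≤m+n _ o)) x))
      where
      open ≡-Reasoning
      j′ = T ℕ.* suc q ℕ.+ o
      H = quotient pow-Δ≈∑S^k
      V = ⟦ pow Δ (suc j′) ⟧ u
      exponent : suc (suc q ℕ.+ T ℕ.* suc q ℕ.+ o) ≡ suc j′ ℕ.+ suc q
      exponent = cong suc (rearrange (suc q) (T ℕ.* suc q) o)
        where
        rearrange : ∀ a b c → a ℕ.+ b ℕ.+ c ≡ b ℕ.+ c ℕ.+ a
        rearrange = ℕ-solve-∀
      split : ⟦ pow Δ (suc (suc q ℕ.+ T ℕ.* suc q ℕ.+ o)) ⟧ u x ≡ π * ⟦ H ⟧ V x
      split = begin
        ⟦ pow Δ (suc (suc q ℕ.+ T ℕ.* suc q ℕ.+ o)) ⟧ u x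
          ≡⟨ cong (λ k → ⟦ pow Δ k ⟧ u x) exponent ⟩
        ⟦ pow Δ (suc j′ ℕ.+ suc q) ⟧ u x
          ≡⟨ Prod-+ (λ _ → Δ) (suc j′) (suc q) u x ⟩
        ⟦ pow Δ (suc q) ⟧ V x
          ≡⟨ equality pow-Δ≈∑S^k V x ⟩
        ⟦ poly (λ _ → + 1) (suc q) ⟧ V x + π * ⟦ H ⟧ V x
          ≡⟨ cong (_+ π * ⟦ H ⟧ V x)
                  (∑S^k∘Δ-periodic≡0 (suc q) (⟦ pow Δ j′ ⟧ u) (⟦⟧-periodic (pow Δ j′) u-per) x) ⟩
        + 0 + π * ⟦ H ⟧ V x
          ≡⟨ +-identityˡ _ ⟩
        π * ⟦ H ⟧ V x ∎

    pow-Δ-∣ : ∀ β T j u → Periodic (p ℕ.^ suc β) u → T ℕ.* (p ℕ.^ β ℕ.* suc q) ℕ.+ p ℕ.^ β ℕ.≤ j →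
              π ^ T ∣ᶠ ⟦ pow Δ j ⟧ u
    pow-Δ-∣ zero T zero    u u-per le = contradiction (ℕP.m+n≤o⇒n≤o (T ℕ.* (1 ℕ.* suc q)) le) λ ()
    pow-Δ-∣ zero T (suc j) u u-per le =
      pow-Δ-∣-Fleck T j u (subst (λ L → Periodic L u) (ℕP.*-identityʳ p) u-per) (ℕP.≤-pred le′)
      where
      le′ : suc (T ℕ.* suc q) ℕ.≤ suc j
      le′ = subst (ℕ._≤ suc j) (trans (ℕP.+-comm _ 1) (cong (λ g → suc (T ℕ.* g)) (ℕP.*-identityˡ (suc q)))) le
    pow-Δ-∣ (suc β) T j u u-per le = BlockProducts.Prod-∣ p (λ _ → Δ) (λ _ → pow-Δ≈Δ[p]) (1≤p^β*[p-1] β)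
      (λ T j v v-per le → pow-Δ[]-∣ p (p ℕ.^ suc β) j (λ w w-per → pow-Δ-∣ β T j w w-per le) v v-per)
      T j u u-per (subst (ℕ._≤ j) (regroup T (p ℕ.^ β) (suc q) p) le)
      where
      regroup : ∀ T P Q p → T ℕ.* ((p ℕ.* P) ℕ.* Q) ℕ.+ p ℕ.* P ≡ (T ℕ.* (P ℕ.* Q) ℕ.+ P) ℕ.* p
      regroup = ℕ-solve-∀

    Prod-rising-∣ : ∀ y β T n u → Periodic (p ℕ.^ suc β ℕ.* suc q) u →
                    T ℕ.* (p ℕ.^ suc β ℕ.* suc q) ℕ.+ p ℕ.^ suc β ℕ.≤ n → π ^ T ∣ᶠ ⟦ Prod (Rising.factor y) n ⟧ u
    Prod-rising-∣ y β T n u u-per le = BlockProducts.Prod-∣ p (Rising.factor y) (rising-block≈ y) (1≤p^β*[p-1] β)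
      (λ T j v v-per le → pow-Δ[]-∣ (suc q) (p ℕ.^ suc β) j (λ w w-per → pow-Δ-∣ β T j w w-per le)
                                    v (subst (λ L → Periodic L v) (ℕP.*-comm (p ℕ.^ suc β) (suc q)) v-per))
      T n u u-per (subst (ℕ._≤ n) (regroup T (p ℕ.^ β) (suc q) p) le)
      where
      regroup : ∀ T P Q p → T ℕ.* ((p ℕ.* P) ℕ.* Q) ℕ.+ p ℕ.* P ≡ (T ℕ.* (P ℕ.* Q) ℕ.+ P) ℕ.* p
      regroup = ℕ-solve-∀

    p^T∣m!*stirSum : ∀ n m β a r T → T ℕ.* (p ℕ.^ suc β ℕ.* suc q) ℕ.+ p ℕ.^ suc β ℕ.≤ n →
                     p ℕ.^ T ℕD.∣ m ! ℕ.* ∣ stirSum n m (p ℕ.^ suc β ℕ.* suc q) a r ∣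
    p^T∣m!*stirSum n m β a r T le =
      subst₂ ℕD._∣_ (cong ∣_∣ (sym (pos-^ p T))) (abs-* (+ (m !)) _) (∣⇒∣ᵤ π^T∣m!*stirSum)
      where
      open StirlingSum n m (p ℕ.^ suc β ℕ.* suc q) a r
      π^T∣m!*stirSum : π ^ T ∣ + (m !) * stirSum n m (p ℕ.^ suc β ℕ.* suc q) a r
      π^T∣m!*stirSum = subst (π ^ T ∣_) (sym m!*stirSum≡) (∑-∣ m (λ j _ → ∣n⇒∣m*n (signedBinom m j)
        (subst (π ^ T ∣_) (Rising.⟦Prod-factor⟧ (+ j * a) n indicator r)
                           (Prod-rising-∣ (+ j * a) β T n indicator indicator-periodic le r))))

open import Defs
open import Data.Nat using (ℕ; _≥_; _!; _^_; _*_; _∸_)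
open import Data.Nat.Primality using (Prime; ¬prime[0]; ¬prime[1])
open import Data.Integer using (ℤ; +_; _-_)
import Data.Nat as ℕ
open import Relation.Nullary using (contradiction)
open Lemmas using (IsOrd-∣-cancel; ≤-floorDiv; module ModPrime)

theorem1p3 : (p n m α : ℕ) → Prime p → n ≥ 1 → m ≥ 1 → α ≥ 1 →
    (a r : ℤ) → (e : ℕ) → IsOrd p (m !) e →
    OrdGe p (stirSum n m (p ^ α * (p ∸ 1)) a r)
      (floorDiv (+ n - + (p ^ α)) (p ^ α * (p ∸ 1)) - + e)
theorem1p3 0 _ _ _ p-prime = contradiction p-prime ¬prime[0]
theorem1p3 1 _ _ _ p-prime = contradiction p-prime ¬prime[1]
theorem1p3 (ℕ.2+ q) n m (ℕ.suc β) p-prime _ _ _ a r e ord i i≤bound =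
  IsOrd-∣-cancel i p-prime ord
    (p^T∣m!*stirSum n m β a r (i ℕ.+ e) (≤-floorDiv n _ _ i e (1≤p^β*[p-1] (ℕ.suc β)) i≤bound))
  where open ModPrime q p-prime
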